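{- For all $k\geq1$, $$\mathcal{D}_{12\mbox{ - }3\mbox{ - }\ldots\mbox{ - } k}(x)=\mathcal{D}_{1\mbox{ - }2\mbox{ - }3\mbox{ - }\ldots\mbox{ - } k}(x)=F_k(x)+xF_{k-1}(x).$$
   Context: A permutation $\pi$ is a Dumont permutation (of the first kind) if each even integer in $\pi$ is followed by a smaller integer, and each odd integer is either followed by a larger integer or is the last element of $\pi$. Generalized patterns: dashes between letters allow arbitrary gaps, while letters written adjacently (as $12$ in $12\mbox{ - }3\mbox{ - }\cdots\mbox{ - }k$) must be adjacent in the permutation; $1\mbox{ - }2\mbox{ - }\cdots\mbox{ - }k$ is the classical pattern $12\cdots k$. For a (generalized) pattern $\tau$, $\mathcal{D}_\tau(x)=\sum_{n\geq0}\mathcal{D}_\tau(n)x^n$ where $\mathcal{D}_\tau(n)$ is the number of Dumont permutations of length $n$ avoiding $1\mbox{ - }3\mbox{ - }2$ and $\tau$. For $r\geq2$ consider $Q_r(x)=1+\frac{x^2Q_{r-1}(x)}{1-x^2Q_{r-2}(x)}$; $F_r(x)$ is its solution with $Q_0=0$, $Q_1=1$. -}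

module Defs where

open import Data.Nat using (ℕ; zero; suc; _+_; _∸_; _<_; _≤_)
open import Data.Nat.Divisibility using (_∣_)
open import Data.Integer as ℤ using (ℤ)
open import Data.Fin using (Fin; toℕ) renaming (_<_ to _<ᶠ_)
open import Data.List using (List; length; lookup; map; upTo)
open import Data.List.Relation.Binary.Permutation.Propositional using (_↭_)
open import Data.Product using (Σ; ∃; ∃-syntax; _×_)
open import Data.Sum using (_⊎_)
open import Relation.Nullary using (¬_)
open import Relation.Binary.PropositionalEquality using (_≡_)

IsPerm : ℕ → List ℕ → Set
IsPerm n π = π ↭ map suc (upTo n)

Even : ℕ → Set
Even m = 2 ∣ m

Odd : ℕ → Set
Odd m = ¬ (2 ∣ m)

IsDumontList : List ℕ → Set
IsDumontList π =
  (i : Fin (length π)) →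
    (Even (lookup π i) →
       ∃[ j ] (toℕ j ≡ suc (toℕ i) × lookup π j < lookup π i))
  × (Odd (lookup π i) →
       (suc (toℕ i) ≡ length π)
       ⊎ ∃[ j ] (toℕ j ≡ suc (toℕ i) × lookup π i < lookup π j))

IsDumont : ℕ → List ℕ → Set
IsDumont n π = IsPerm n π × IsDumontList π

Contains132 : List ℕ → Set
Contains132 π = ∃[ i ] ∃[ j ] ∃[ l ]
  (i <ᶠ j × j <ᶠ l × lookup π i < lookup π l × lookup π l < lookup π j)

IncOccurrence : (k : ℕ) (π : List ℕ) → (Fin k → Fin (length π)) → Set
IncOccurrence k π f =
  ((a b : Fin k) → a <ᶠ b → f a <ᶠ f b)
  × ((a b : Fin k) → a <ᶠ b → lookup π (f a) < lookup π (f b))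

ContainsInc : ℕ → List ℕ → Set
ContainsInc k π = ∃[ f ] IncOccurrence k π f

ContainsAdjInc : ℕ → List ℕ → Set
ContainsAdjInc k π = ∃[ f ] (IncOccurrence k π f ×
  ((a b : Fin k) → toℕ a ≡ 0 → toℕ b ≡ 1 → toℕ (f b) ≡ suc (toℕ (f a))))

Series : Set
Series = ℕ → ℤ

_≈ˢ_ : Series → Series → Set
f ≈ˢ g = (n : ℕ) → f n ≡ g n

0ˢ : Series
0ˢ _ = ℤ.0ℤ

1ˢ : Series
1ˢ zero = ℤ.1ℤ
1ˢ (suc _) = ℤ.0ℤ

_+ˢ_ : Series → Series → Series
(f +ˢ g) n = f n ℤ.+ g n

_-ˢ_ : Series → Series → Series
(f -ˢ g) n = f n ℤ.- g n

sumTo : (ℕ → ℤ) → ℕ → ℤ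
sumTo h zero = h zero
sumTo h (suc m) = sumTo h m ℤ.+ h (suc m)

_*ˢ_ : Series → Series → Series
(f *ˢ g) n = sumTo (λ i → f i ℤ.* g (n ∸ i)) n

xˢ : Series → Series
xˢ f zero = ℤ.0ℤ
xˢ f (suc n) = f n

x²ˢ : Series → Series
x²ˢ f = xˢ (xˢ f)

{-# OPTIONS --safe #-}
-- In a 132-avoiding permutation every entry to the left of the maximum exceeds every entry to its
-- right. Together with the Dumont condition this splits a permutation counted by Q r (of even length,
-- avoiding the increasing pattern of length r) as  σ (c + 2) γ (c + 1),  where the entries of γ are
-- smaller and those of σ larger than c + 1 and c + 2, γ is counted by Q (r - 1), and σ is a sequence
-- of blocks  α c′ (c′ + 1),  each above the next, with α counted by Q (r - 2). So σ is counted by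
-- I (r - 2) = 1 / (1 - x² Q (r - 2)), and Q r = 1 + x² Q (r - 1) I (r - 2).
-- A Dumont permutation of odd length n ends with n, and removing it gives the term x Q (r - 1).
-- Both patterns 12-3-…-k and 1-2-…-k enter only through the properties collected in
-- IncreasingPattern, so a single list of permutations enumerates both classes.
module Submission where

open import Defs
open import Data.Nat using (ℕ; zero; suc; _+_; _*_; _∸_; _<_; _≤_; z≤n; s≤s; s≤s⁻¹)
open import Data.Nat.Properties
open import Data.Nat.Divisibility using (divides)
open import Data.Nat.Tactic.RingSolver using (solve-∀)
open import Data.Integer as ℤ using (ℤ; +_)
import Data.Integer.Properties as ℤ
open import Data.Integer.Tactic.RingSolver using () renaming (solve-∀ to ℤ-solve-∀)
open import Data.Fin using (Fin; toℕ; inject≤; reduce≥; fromℕ<) renaming (zero to fzero; suc to fsuc; _<_ to _<ᶠ_)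
open import Data.Fin.Properties using (toℕ-inject≤; toℕ-injective; toℕ<n)
open import Data.List
  using (List; []; _∷_; _++_; _∷ʳ_; [_]; length; lookup; tabulate; map; upTo; applyDownFrom; cartesianProductWith; initLast; _∷ʳ′_)
open import Data.List.Properties
  using (++-assoc; ++-identityʳ; ++-cancelʳ; length-++; length-map; length-tabulate; length-applyDownFrom;
         ∷-injective; ∷ʳ-injectiveˡ; ∷ʳ-injectiveʳ; map-upTo; reverse-applyUpTo)
open import Data.List.Membership.Propositional using (_∈_; _∉_)
open import Data.List.Membership.Propositional.Properties
  using (∈-++⁺ˡ; ∈-++⁺ʳ; ∈-++⁻; ∈-∃++; ∈-map⁺; ∈-map⁻; ∈-lookup; ∈-cartesianProductWith⁺; ∈-cartesianProductWith⁻)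
open import Data.List.Relation.Unary.Any using (here; there)
open import Data.List.Relation.Unary.All as All using (All; []; _∷_)
open import Data.List.Relation.Unary.AllPairs using (AllPairs; []; _∷_) renaming (head to AllPairs-head)
import Data.List.Relation.Unary.AllPairs.Properties as AllPairs
open import Data.List.Relation.Unary.Unique.Propositional using (Unique)
import Data.List.Relation.Unary.Unique.Propositional.Properties as Unique
open import Data.List.Relation.Binary.Sublist.Propositional
  using (_⊆_; []; _∷_; ⊆-refl; from∈) renaming (_∷ʳ_ to skip; lookup to ⊆-lookup)
open import Data.List.Relation.Binary.Sublist.Propositional.Properties
  using (∷⁻; []⊆-universal; ++⁺; ++⁺ˡ; ++⁺ʳ; length-mono-≤)
open import Data.List.Relation.Binary.Permutation.Propositional
  using (_↭_; ↭-refl; ↭-sym; ↭-trans; ↭-reflexive; prep; swap; ↭⇒↭ₛ)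
import Data.List.Relation.Binary.Permutation.Propositional.Properties as ↭
open import Data.List.Relation.Binary.Permutation.Propositional.Properties
  using (∈-resp-↭; ↭-length; ↭-empty-inv; ↭-reverse; drop-mid; drop-∷; shift; ∷↭∷ʳ; ++-comm)
import Data.List.Relation.Binary.Permutation.Setoid.Properties
open import Data.Maybe using (Maybe; just; nothing)
import Data.Maybe.Relation.Unary.All as Maybe
open import Data.Product using (∃-syntax; _×_; _,_; proj₁; proj₂)
open import Data.Sum as Sum using (_⊎_; inj₁; inj₂; [_,_]′)
open import Data.Empty using (⊥; ⊥-elim)
open import Data.Unit using (⊤; tt)
open import Function using (_∘_)
open import Function.Bundles using (_⇔_; mk⇔)
open import Relation.Nullary using (¬_)
open import Relation.Binary.Definitions using (tri<; tri≈; tri>)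
open import Relation.Binary.PropositionalEquality hiding ([_])

StrictlyMonotone : ∀ {k m} → (Fin k → Fin m) → Set
StrictlyMonotone f = ∀ a b → a <ᶠ b → f a <ᶠ f b

index : ∀ {xs ys : List ℕ} → xs ⊆ ys → Fin (length xs) → Fin (length ys)
index (skip y p) i = fsuc (index p i)
index (refl ∷ p) fzero = fzero
index (refl ∷ p) (fsuc i) = fsuc (index p i)

index-mono : ∀ {xs ys : List ℕ} (p : xs ⊆ ys) → StrictlyMonotone (index p)
index-mono (skip y p) a b a<b = s≤s (index-mono p a b a<b)
index-mono (refl ∷ p) fzero (fsuc b) _ = s≤s z≤n
index-mono (refl ∷ p) (fsuc a) (fsuc b) (s≤s a<b) = s≤s (index-mono p a b a<b)

lookup-index : ∀ {xs ys : List ℕ} (p : xs ⊆ ys) i → lookup ys (index p i) ≡ lookup xs i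
lookup-index (skip y p) i = lookup-index p i
lookup-index (refl ∷ p) fzero = refl
lookup-index (refl ∷ p) (fsuc i) = lookup-index p i

toℕ-index-++⁺ˡ : ∀ {xs ys : List ℕ} pre (p : xs ⊆ ys) i → toℕ (index (++⁺ˡ pre p) i) ≡ length pre + toℕ (index p i)
toℕ-index-++⁺ˡ [] p i = refl
toℕ-index-++⁺ˡ (x ∷ pre) p i = cong suc (toℕ-index-++⁺ˡ pre p i)

module Untail {x : ℕ} {xs : List ℕ} {k} (f : Fin k → Fin (length (x ∷ xs))) (pos : ∀ a → 0 < toℕ (f a)) where

  untail : Fin k → Fin (length xs)
  untail a = reduce≥ {1} (f a) (pos a)

  f≡fsuc∘untail : ∀ a → f a ≡ fsuc (untail a)
  f≡fsuc∘untail a = go (f a) (pos a)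
    where
    go : (i : Fin (suc (length xs))) (h : 0 < toℕ i) → i ≡ fsuc (reduce≥ {1} i h)
    go (fsuc i) _ = refl

  untail-mono : StrictlyMonotone f → StrictlyMonotone untail
  untail-mono mono a b a<b = s≤s⁻¹ (subst₂ _<ᶠ_ (f≡fsuc∘untail a) (f≡fsuc∘untail b) (mono a b a<b))

  lookup-untail : ∀ a → lookup (x ∷ xs) (f a) ≡ lookup xs (untail a)
  lookup-untail a = cong (lookup (x ∷ xs)) (f≡fsuc∘untail a)

nonzero-after-head : ∀ {k m} (f : Fin (suc k) → Fin (suc m)) → StrictlyMonotone f →
                     0 < toℕ (f fzero) → ∀ a → 0 < toℕ (f a)
nonzero-after-head f mono h fzero = h
nonzero-after-head f mono h (fsuc a) = <-≤-trans h (<⇒≤ (mono fzero (fsuc a) (s≤s z≤n)))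

tabulate-⊆ : ∀ π {k} (f : Fin k → Fin (length π)) → StrictlyMonotone f →
             (v : Fin k → ℕ) → (∀ a → lookup π (f a) ≡ v a) → tabulate v ⊆ π
tabulate-⊆ π {zero} f mono v eq = []⊆-universal π
tabulate-⊆ [] {suc k} f mono v eq with f fzero
... | ()
tabulate-⊆ (x ∷ xs) {suc k} f mono v eq with f fzero in f0
... | fzero = trans (sym (eq fzero)) (cong (lookup (x ∷ xs)) f0)
              ∷ tabulate-⊆ xs untail (untail-mono mono′) (v ∘ fsuc) (λ a → trans (sym (lookup-untail a)) (eq (fsuc a)))
  where
  f′ : Fin k → Fin (length (x ∷ xs))
  f′ = f ∘ fsuc
  mono′ : StrictlyMonotone f′
  mono′ a b a<b = mono (fsuc a) (fsuc b) (s≤s a<b)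
  pos : ∀ a → 0 < toℕ (f′ a)
  pos a = subst (λ i → toℕ i < toℕ (f′ a)) f0 (mono fzero (fsuc a) (s≤s z≤n))
  open Untail {x} {xs} f′ pos
... | fsuc _ = skip x (tabulate-⊆ xs untail (untail-mono mono) v (λ a → trans (sym (lookup-untail a)) (eq a)))
  where open Untail {x} {xs} f (nonzero-after-head f mono (subst (λ i → 0 < toℕ i) (sym f0) (s≤s z≤n)))

AdjacentThen : ℕ → ℕ → List ℕ → List ℕ → Set
AdjacentThen x y zs π = ∃[ pre ] ∃[ post ] π ≡ pre ++ x ∷ y ∷ post × zs ⊆ post

adjacent-⊆ : ∀ π {k} (f : Fin (suc (suc k)) → Fin (length π)) → StrictlyMonotone f →
             toℕ (f (fsuc fzero)) ≡ suc (toℕ (f fzero)) →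
             (v : Fin (suc (suc k)) → ℕ) → (∀ a → lookup π (f a) ≡ v a) →
             AdjacentThen (v fzero) (v (fsuc fzero)) (tabulate (v ∘ fsuc ∘ fsuc)) π
adjacent-⊆ [] f mono adj v eq with f fzero
... | ()
adjacent-⊆ (x ∷ xs) f mono adj v eq with f fzero in f0
adjacent-⊆ (x ∷ []) f mono adj v eq | fzero with f (fsuc fzero) | adj
... | fzero | ()
adjacent-⊆ (x ∷ y ∷ ys) f mono adj v eq | fzero =
  [] , ys , cong₂ _∷_ x≡v₀ (cong (_∷ ys) y≡v₁) , ∷⁻ (∷⁻ (tabulate-⊆ (x ∷ y ∷ ys) f mono v eq))
  where
  x≡v₀ : x ≡ v fzero
  x≡v₀ = trans (cong (lookup (x ∷ y ∷ ys)) (sym f0)) (eq fzero)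
  y≡v₁ : y ≡ v (fsuc fzero)
  y≡v₁ = trans (cong (lookup (x ∷ y ∷ ys)) (sym (toℕ-injective {j = fsuc fzero} adj)))
               (eq (fsuc fzero))
adjacent-⊆ (x ∷ xs) f mono adj v eq | fsuc _ =
  let pre , post , π≡ , zs⊆ = adjacent-⊆ xs untail (untail-mono mono) adj′ v (λ a → trans (sym (lookup-untail a)) (eq a))
  in x ∷ pre , post , cong (x ∷_) π≡ , zs⊆
  where
  open Untail {x} {xs} f (nonzero-after-head f mono (subst (λ i → 0 < toℕ i) (sym f0) (s≤s z≤n)))
  adj′ : toℕ (untail (fsuc fzero)) ≡ suc (toℕ (untail fzero))
  adj′ = suc-injective (subst₂ (λ i j → toℕ i ≡ suc (toℕ j)) (f≡fsuc∘untail (fsuc fzero)) (f≡fsuc∘untail fzero)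
                   (subst (λ i → toℕ (f (fsuc fzero)) ≡ suc (toℕ i)) (sym f0) adj))

AllPairs-lookup : ∀ {R : ℕ → ℕ → Set} {zs} → AllPairs R zs → ∀ a b → a <ᶠ b → R (lookup zs a) (lookup zs b)
AllPairs-lookup (r ∷ rs) fzero (fsuc b) _ = All.lookup r (∈-lookup b)
AllPairs-lookup (r ∷ rs) (fsuc a) (fsuc b) (s≤s a<b) = AllPairs-lookup rs a b a<b

IncreasingSublist : ℕ → List ℕ → Set
IncreasingSublist k π = ∃[ zs ] (zs ⊆ π × k ≤ length zs × AllPairs _<_ zs)

Sublist132 : List ℕ → Set
Sublist132 π = ∃[ a ] ∃[ b ] ∃[ c ] (a ∷ b ∷ c ∷ [] ⊆ π × a < c × c < b)

AdjIncreasingSublist : ℕ → List ℕ → Set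
AdjIncreasingSublist zero π = ⊤
AdjIncreasingSublist (suc zero) π = 0 < length π
AdjIncreasingSublist (suc (suc k)) π =
  ∃[ x ] ∃[ y ] ∃[ zs ] (AdjacentThen x y zs π × AllPairs _<_ (x ∷ y ∷ zs) × k ≤ length zs)

module Embed {zs π : List ℕ} (p : zs ⊆ π) {k} (k≤ : k ≤ length zs) where

  inject≤-mono : ∀ a b → a <ᶠ b → inject≤ a k≤ <ᶠ inject≤ b k≤
  inject≤-mono a b = subst₂ _<_ (sym (toℕ-inject≤ a k≤)) (sym (toℕ-inject≤ b k≤))

  embed : Fin k → Fin (length π)
  embed a = index p (inject≤ a k≤)

  embed-mono : StrictlyMonotone embed
  embed-mono a b a<b = index-mono p _ _ (inject≤-mono a b a<b)

  embed-increasing : AllPairs _<_ zs → ∀ a b → a <ᶠ b → lookup π (embed a) < lookup π (embed b)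
  embed-increasing inc a b a<b =
    subst₂ _<_ (sym (lookup-index p _)) (sym (lookup-index p _)) (AllPairs-lookup inc _ _ (inject≤-mono a b a<b))

ContainsInc⇒IncreasingSublist : ∀ k π → ContainsInc k π → IncreasingSublist k π
ContainsInc⇒IncreasingSublist k π (f , mono , inc) =
  tabulate v , tabulate-⊆ π f mono v (λ _ → refl) , ≤-reflexive (sym (length-tabulate v)) , AllPairs.tabulate⁺-< (inc _ _)
  where
  v : Fin k → ℕ
  v = lookup π ∘ f

IncreasingSublist⇒ContainsInc : ∀ k π → IncreasingSublist k π → ContainsInc k π
IncreasingSublist⇒ContainsInc k π (zs , p , k≤ , inc) = embed , embed-mono , embed-increasing inc
  where open Embed p k≤

Contains132⇒Sublist132 : ∀ π → Contains132 π → Sublist132 π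
Contains132⇒Sublist132 π (i , j , l , i<j , j<l , πi<πl , πl<πj) =
  _ , _ , _ , tabulate-⊆ π f mono (lookup π ∘ f) (λ _ → refl) , πi<πl , πl<πj
  where
  f : Fin 3 → Fin (length π)
  f fzero = i
  f (fsuc fzero) = j
  f (fsuc (fsuc fzero)) = l
  mono : StrictlyMonotone f
  mono fzero (fsuc fzero) _ = i<j
  mono fzero (fsuc (fsuc fzero)) _ = <-trans i<j j<l
  mono (fsuc fzero) (fsuc (fsuc fzero)) _ = j<l
  mono fzero fzero ()
  mono (fsuc fzero) fzero ()
  mono (fsuc fzero) (fsuc fzero) (s≤s ())
  mono (fsuc (fsuc fzero)) fzero ()
  mono (fsuc (fsuc fzero)) (fsuc fzero) (s≤s ())
  mono (fsuc (fsuc fzero)) (fsuc (fsuc fzero)) (s≤s (s≤s ()))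

Sublist132⇒Contains132 : ∀ π → Sublist132 π → Contains132 π
Sublist132⇒Contains132 π (a , b , c , p , a<c , c<b) =
  index p i , index p j , index p l ,
  index-mono p i j (s≤s z≤n) , index-mono p j l (s≤s (s≤s z≤n)) ,
  subst₂ _<_ (sym (lookup-index p i)) (sym (lookup-index p l)) a<c ,
  subst₂ _<_ (sym (lookup-index p l)) (sym (lookup-index p j)) c<b
  where
  i j l : Fin 3
  i = fzero
  j = fsuc fzero
  l = fsuc (fsuc fzero)

ContainsAdjInc⇒AdjIncreasingSublist : ∀ k π → ContainsAdjInc k π → AdjIncreasingSublist k π
ContainsAdjInc⇒AdjIncreasingSublist zero π _ = tt
ContainsAdjInc⇒AdjIncreasingSublist (suc zero) π (f , _) = ≤-<-trans z≤n (toℕ<n (f fzero))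
ContainsAdjInc⇒AdjIncreasingSublist (suc (suc k)) π (f , (mono , inc) , adj) =
  v fzero , v (fsuc fzero) , tabulate (v ∘ fsuc ∘ fsuc) ,
  adjacent-⊆ π f mono (adj fzero (fsuc fzero) refl refl) v (λ _ → refl) ,
  AllPairs.tabulate⁺-< (inc _ _) , ≤-reflexive (sym (length-tabulate _))
  where
  v : Fin (suc (suc k)) → ℕ
  v = lookup π ∘ f

AdjIncreasingSublist⇒ContainsAdjInc : ∀ k π → AdjIncreasingSublist k π → ContainsAdjInc k π
AdjIncreasingSublist⇒ContainsAdjInc zero π _ = (λ ()) , ((λ ()) , (λ ())) , (λ ())
AdjIncreasingSublist⇒ContainsAdjInc (suc zero) π 0<∣π∣ =
  (λ _ → fromℕ< 0<∣π∣) , ((λ { fzero fzero () }) , (λ { fzero fzero () })) , (λ { fzero fzero _ () })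
AdjIncreasingSublist⇒ContainsAdjInc (suc (suc k)) π (x , y , zs , (pre , post , refl , s) , inc , k≤) =
  embed , (embed-mono , embed-increasing inc) , adjacent
  where
  open Embed (++⁺ˡ pre (refl ∷ refl ∷ s)) (s≤s (s≤s k≤))
  adjacent : ∀ a b → toℕ a ≡ 0 → toℕ b ≡ 1 → toℕ (embed b) ≡ suc (toℕ (embed a))
  adjacent fzero (fsuc fzero) _ _ = trans (toℕ-index-++⁺ˡ pre _ (fsuc fzero))
    (trans (+-suc (length pre) 0) (cong suc (sym (toℕ-index-++⁺ˡ pre _ fzero))))
  adjacent fzero fzero _ ()
  adjacent fzero (fsuc (fsuc _)) _ ()

Above : List ℕ → List ℕ → Set
Above xs ys = ∀ {x y} → x ∈ xs → y ∈ ys → y < x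

AllBelow : ℕ → List ℕ → Set
AllBelow M xs = ∀ {x} → x ∈ xs → x < M

split-⊆-++ : ∀ xs {ys zs : List ℕ} → zs ⊆ xs ++ ys →
             ∃[ zs₁ ] ∃[ zs₂ ] (zs ≡ zs₁ ++ zs₂ × zs₁ ⊆ xs × zs₂ ⊆ ys)
split-⊆-++ [] p = [] , _ , refl , [] , p
split-⊆-++ (x ∷ xs) (skip .x p) =
  let zs₁ , zs₂ , eq , p₁ , p₂ = split-⊆-++ xs p in zs₁ , zs₂ , eq , skip x p₁ , p₂
split-⊆-++ (x ∷ xs) (refl ∷ p) =
  let zs₁ , zs₂ , eq , p₁ , p₂ = split-⊆-++ xs p in x ∷ zs₁ , zs₂ , cong (x ∷_) eq , refl ∷ p₁ , p₂

AllPairs-⊆ : ∀ {R : ℕ → ℕ → Set} {zs π} → zs ⊆ π → AllPairs R π → AllPairs R zs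
AllPairs-⊆ [] rs = rs
AllPairs-⊆ (skip y p) (_ ∷ rs) = AllPairs-⊆ p rs
AllPairs-⊆ (refl ∷ p) (r ∷ rs) = All.tabulate (All.lookup r ∘ ⊆-lookup p) ∷ AllPairs-⊆ p rs

AllPairs-++⁻ : ∀ {R : ℕ → ℕ → Set} xs {ys} → AllPairs R (xs ++ ys) →
               AllPairs R xs × AllPairs R ys × (∀ {x y} → x ∈ xs → y ∈ ys → R x y)
AllPairs-++⁻ xs rs = AllPairs-⊆ (++⁺ʳ _ ⊆-refl) rs , AllPairs-⊆ (++⁺ˡ xs ⊆-refl) rs , cross xs rs
  where
  cross : ∀ {R : ℕ → ℕ → Set} xs {ys} → AllPairs R (xs ++ ys) → ∀ {x y} → x ∈ xs → y ∈ ys → R x y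
  cross (x ∷ xs) (r ∷ rs) (here refl) y∈ = All.lookup r (∈-++⁺ʳ xs y∈)
  cross (x ∷ xs) (r ∷ rs) (there x∈) y∈ = cross xs rs x∈ y∈

AllPairs-∷ʳ⁺ : ∀ {zs M} → AllPairs _<_ zs → AllBelow M zs → AllPairs _<_ (zs ∷ʳ M)
AllPairs-∷ʳ⁺ inc below = AllPairs.++⁺ inc ([] ∷ []) (All.tabulate (λ z∈ → below z∈ ∷ []))

record IncreasingPattern (P : ℕ → List ℕ → Set) : Set₁ where
  field
    contains-0 : ∀ π → P 0 π
    empty-avoids : ∀ k → ¬ P (suc k) []
    contains-1 : ∀ x xs → P 1 (x ∷ xs)
    split-above : ∀ k xs ys → Above xs ys → P k (xs ++ ys) → P k xs ⊎ P k ys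
    weakenʳ : ∀ k xs ys → P k xs → P k (xs ++ ys)
    weakenˡ : ∀ k xs ys → P k ys → P k (xs ++ ys)
    ∷ʳ-max⁻ : ∀ k xs M → AllBelow M xs → P (suc k) (xs ∷ʳ M) → P k xs
    ∷ʳ-max⁺ : ∀ k xs M → AllBelow M xs → P k xs → P (suc k) (xs ∷ʳ M)

  avoids-singleton : ∀ k M → ¬ P (suc (suc k)) [ M ]
  avoids-singleton k M = empty-avoids k ∘ ∷ʳ-max⁻ (suc k) [] M (λ ())

k≤-drop-last : ∀ {k l₁ l₂} → suc k ≤ l₁ + l₂ → l₂ ≤ 1 → k ≤ l₁
k≤-drop-last {l₁ = l₁} h l₂≤1 = s≤s⁻¹ (≤-trans h (≤-trans (+-monoʳ-≤ l₁ l₂≤1) (≤-reflexive (+-comm l₁ 1))))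

length-∷ʳ : ∀ (xs : List ℕ) M → length (xs ∷ʳ M) ≡ suc (length xs)
length-∷ʳ xs M = trans (length-++ xs) (+-comm (length xs) 1)

increasingSublist : IncreasingPattern IncreasingSublist
increasingSublist = record
  { contains-0 = λ π → [] , []⊆-universal π , z≤n , []
  ; empty-avoids = λ { k (.[] , [] , () , _) }
  ; contains-1 = λ x xs → [ x ] , refl ∷ []⊆-universal xs , s≤s z≤n , [] ∷ []
  ; split-above = split-above
  ; weakenʳ = λ { k xs ys (zs , p , k≤ , inc) → zs , ++⁺ʳ ys p , k≤ , inc }
  ; weakenˡ = λ { k xs ys (zs , p , k≤ , inc) → zs , ++⁺ˡ xs p , k≤ , inc }
  ; ∷ʳ-max⁻ = ∷ʳ-max⁻
  ; ∷ʳ-max⁺ = λ { k xs M below (zs , p , k≤ , inc) →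
      zs ∷ʳ M , ++⁺ p (refl ∷ []) , subst (suc k ≤_) (sym (length-∷ʳ zs M)) (s≤s k≤) ,
      AllPairs-∷ʳ⁺ inc (below ∘ ⊆-lookup p) }
  }
  where
  split-above : ∀ k xs ys → Above xs ys → IncreasingSublist k (xs ++ ys) →
                IncreasingSublist k xs ⊎ IncreasingSublist k ys
  split-above k xs ys above (zs , p , k≤ , inc) with split-⊆-++ xs p
  ... | [] , zs₂ , refl , p₁ , p₂ = inj₂ (zs₂ , p₂ , k≤ , inc)
  ... | zs₁ , [] , refl , p₁ , p₂ rewrite ++-identityʳ zs₁ = inj₁ (zs₁ , p₁ , k≤ , inc)
  ... | u ∷ zs₁ , v ∷ zs₂ , refl , p₁ , p₂ =
    ⊥-elim (<-asym (proj₂ (proj₂ (AllPairs-++⁻ (u ∷ zs₁) inc)) (here refl) (here refl))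
                   (above (⊆-lookup p₁ (here refl)) (⊆-lookup p₂ (here refl))))
  ∷ʳ-max⁻ : ∀ k xs M → AllBelow M xs → IncreasingSublist (suc k) (xs ∷ʳ M) → IncreasingSublist k xs
  ∷ʳ-max⁻ k xs M below (zs , p , k≤ , inc) with split-⊆-++ xs p
  ... | zs₁ , zs₂ , refl , p₁ , p₂ =
    zs₁ , p₁ , k≤-drop-last (subst (suc k ≤_) (length-++ zs₁) k≤) (length-mono-≤ p₂) , proj₁ (AllPairs-++⁻ zs₁ inc)

data AdjacentSplit (xs ys pre : List ℕ) (x y : ℕ) (post : List ℕ) : Set where
  inʳ : ∀ pre′ → ys ≡ pre′ ++ x ∷ y ∷ post → AdjacentSplit xs ys pre x y post
  inˡ : ∀ post′ → xs ≡ pre ++ x ∷ y ∷ post′ → post ≡ post′ ++ ys → AdjacentSplit xs ys pre x y post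
  across : xs ≡ pre ∷ʳ x → ys ≡ y ∷ post → AdjacentSplit xs ys pre x y post

adjacentSplit : ∀ xs ys pre x y post → xs ++ ys ≡ pre ++ x ∷ y ∷ post → AdjacentSplit xs ys pre x y post
adjacentSplit [] ys pre x y post eq = inʳ pre eq
adjacentSplit (u ∷ []) ys [] x y post refl = across refl refl
adjacentSplit (u ∷ v ∷ xs) ys [] x y post refl = inˡ xs refl refl
adjacentSplit (u ∷ xs) ys (_ ∷ pre) x y post eq with ∷-injective eq
... | refl , eq′ with adjacentSplit xs ys pre x y post eq′
... | inʳ pre′ eq₁ = inʳ pre′ eq₁
... | inˡ post′ eq₁ eq₂ = inˡ post′ (cong (u ∷_) eq₁) eq₂
... | across eq₁ eq₂ = across (cong (u ∷_) eq₁) eq₂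

[]≢adjacent : ∀ pre {x y : ℕ} {post} → [] ≢ pre ++ x ∷ y ∷ post
[]≢adjacent [] ()
[]≢adjacent (_ ∷ _) ()

[M]≢adjacent : ∀ {M : ℕ} pre {x y post} → [ M ] ≢ pre ++ x ∷ y ∷ post
[M]≢adjacent [] ()
[M]≢adjacent (_ ∷ pre) eq = []≢adjacent pre (proj₂ (∷-injective eq))

adjIncreasingSublist : IncreasingPattern AdjIncreasingSublist
adjIncreasingSublist = record
  { contains-0 = λ _ → tt
  ; empty-avoids = λ { zero () ; (suc k) (_ , _ , _ , (pre , _ , eq , _) , _) → []≢adjacent pre eq }
  ; contains-1 = λ _ _ → s≤s z≤n
  ; split-above = split-above
  ; weakenʳ = weakenʳ
  ; weakenˡ = weakenˡ
  ; ∷ʳ-max⁻ = ∷ʳ-max⁻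
  ; ∷ʳ-max⁺ = ∷ʳ-max⁺
  }
  where
  P : ℕ → List ℕ → Set
  P = AdjIncreasingSublist

  split-above : ∀ k xs ys → Above xs ys → P k (xs ++ ys) → P k xs ⊎ P k ys
  split-above zero xs ys _ _ = inj₁ tt
  split-above (suc zero) [] ys _ h = inj₂ h
  split-above (suc zero) (u ∷ xs) ys _ _ = inj₁ (s≤s z≤n)
  split-above (suc (suc k)) xs ys above (x , y , zs , (pre , post , eq , s) , inc , k≤)
    with adjacentSplit xs ys pre x y post eq
  ... | inʳ pre′ eq₁ = inj₂ (x , y , zs , (pre′ , post , eq₁ , s) , inc , k≤)
  ... | across refl refl = ⊥-elim (<-asym (All.lookup (AllPairs-head inc) (here refl)) (above (∈-++⁺ʳ pre (here refl)) (here refl)))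
  ... | inˡ post′ refl refl with split-⊆-++ post′ s
  ...   | zs₁ , [] , refl , s₁ , _ rewrite ++-identityʳ zs₁ = inj₁ (x , y , zs₁ , (pre , post′ , refl , s₁) , inc , k≤)
  ...   | zs₁ , v ∷ _ , refl , _ , s₂ =
    ⊥-elim (<-asym (All.lookup (AllPairs-head inc) (there (∈-++⁺ʳ zs₁ (here refl))))
                   (above (∈-++⁺ʳ pre (here refl)) (⊆-lookup s₂ (here refl))))

  weakenʳ : ∀ k xs ys → P k xs → P k (xs ++ ys)
  weakenʳ zero _ _ _ = tt
  weakenʳ (suc zero) (_ ∷ _) _ _ = s≤s z≤n
  weakenʳ (suc (suc k)) _ ys (x , y , zs , (pre , post , refl , s) , inc , k≤) =
    x , y , zs , (pre , post ++ ys , ++-assoc pre (x ∷ y ∷ post) ys , ++⁺ʳ ys s) , inc , k≤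

  weakenˡ : ∀ k xs ys → P k ys → P k (xs ++ ys)
  weakenˡ zero _ _ _ = tt
  weakenˡ (suc zero) [] _ h = h
  weakenˡ (suc zero) (_ ∷ _) _ _ = s≤s z≤n
  weakenˡ (suc (suc k)) xs _ (x , y , zs , (pre , post , refl , s) , inc , k≤) =
    x , y , zs , (xs ++ pre , post , sym (++-assoc xs pre _) , s) , inc , k≤

  ∷ʳ-max⁻ : ∀ k xs M → AllBelow M xs → P (suc k) (xs ∷ʳ M) → P k xs
  ∷ʳ-max⁻ zero _ _ _ _ = tt
  ∷ʳ-max⁻ (suc zero) [] M _ (_ , _ , _ , (pre , _ , eq , _) , _) = ⊥-elim ([M]≢adjacent pre eq)
  ∷ʳ-max⁻ (suc zero) (_ ∷ _) _ _ _ = s≤s z≤n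
  ∷ʳ-max⁻ (suc (suc k)) xs M _ (x , y , zs , (pre , post , eq , s) , inc , k≤)
    with adjacentSplit xs [ M ] pre x y post eq
  ... | inʳ pre′ eq₁ = ⊥-elim ([M]≢adjacent pre′ eq₁)
  ... | across _ refl with s | k≤
  ...   | [] | ()
  ∷ʳ-max⁻ (suc (suc k)) xs M _ (x , y , zs , (pre , post , eq , s) , inc , k≤) | inˡ post′ eq₁ refl
    with split-⊆-++ post′ s
  ... | zs₁ , zs₂ , refl , s₁ , s₂ =
    x , y , zs₁ , (pre , post′ , eq₁ , s₁) , AllPairs-⊆ (refl ∷ refl ∷ ++⁺ʳ zs₂ ⊆-refl) inc ,
    k≤-drop-last (subst (suc k ≤_) (length-++ zs₁) k≤) (length-mono-≤ s₂)

  ∷ʳ-max⁺ : ∀ k xs M → AllBelow M xs → P k xs → P (suc k) (xs ∷ʳ M)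
  ∷ʳ-max⁺ zero xs M _ _ = subst (0 <_) (sym (length-∷ʳ xs M)) (s≤s z≤n)
  ∷ʳ-max⁺ (suc zero) xs M below h with initLast xs
  ... | init ∷ʳ′ l = l , M , [] , (init , [] , ++-assoc init [ l ] [ M ] , []) ,
                     (below (∈-++⁺ʳ init (here refl)) ∷ []) ∷ [] ∷ [] , z≤n
  ∷ʳ-max⁺ (suc (suc k)) _ M below (x , y , zs , (pre , post , refl , s) , inc , k≤) =
    x , y , zs ∷ʳ M , (pre , post ∷ʳ M , ++-assoc pre (x ∷ y ∷ post) [ M ] , ++⁺ s (refl ∷ [])) ,
    AllPairs-∷ʳ⁺ inc (below ∘ ⊆-lookup (++⁺ˡ pre (refl ∷ refl ∷ s))) ,
    subst (suc k ≤_) (sym (length-∷ʳ zs M)) (s≤s k≤)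

Sublist132-weakenʳ : ∀ {xs} ys → Sublist132 xs → Sublist132 (xs ++ ys)
Sublist132-weakenʳ ys (a , b , c , p , a<c , c<b) = a , b , c , ++⁺ʳ ys p , a<c , c<b

Sublist132-weakenˡ : ∀ xs {ys} → Sublist132 ys → Sublist132 (xs ++ ys)
Sublist132-weakenˡ xs (a , b , c , p , a<c , c<b) = a , b , c , ++⁺ˡ xs p , a<c , c<b

¬Sublist132-[] : ¬ Sublist132 []
¬Sublist132-[] (_ , _ , _ , () , _)

¬Sublist132-[x] : ∀ {M} → ¬ Sublist132 [ M ]
¬Sublist132-[x] (_ , _ , _ , p , _) with length-mono-≤ p
... | s≤s ()

Sublist132-split : ∀ xs ys → Above xs ys → Sublist132 (xs ++ ys) → Sublist132 xs ⊎ Sublist132 ys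
Sublist132-split xs ys above (a , b , c , p , a<c , c<b) with split-⊆-++ xs p
... | [] , _ , refl , _ , p₂ = inj₂ (a , b , c , p₂ , a<c , c<b)
... | _ ∷ [] , _ , refl , p₁ , p₂ =
  ⊥-elim (<-asym a<c (above (⊆-lookup p₁ (here refl)) (⊆-lookup p₂ (there (here refl)))))
... | _ ∷ _ ∷ [] , _ , refl , p₁ , p₂ =
  ⊥-elim (<-asym a<c (above (⊆-lookup p₁ (here refl)) (⊆-lookup p₂ (here refl))))
... | _ ∷ _ ∷ _ ∷ [] , [] , refl , p₁ , _ = inj₁ (a , b , c , p₁ , a<c , c<b)

Sublist132-∷ʳ-max⁻ : ∀ xs M → AllBelow M xs → Sublist132 (xs ∷ʳ M) → Sublist132 xs
Sublist132-∷ʳ-max⁻ xs M below (a , b , c , p , a<c , c<b) with split-⊆-++ xs p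
... | _ ∷ _ ∷ _ ∷ [] , [] , refl , p₁ , _ = a , b , c , p₁ , a<c , c<b
... | _ ∷ _ ∷ [] , _ ∷ [] , refl , p₁ , refl ∷ [] = ⊥-elim (<-asym c<b (below (⊆-lookup p₁ (there (here refl)))))
... | zs₁ , _ ∷ _ ∷ _ , _ , _ , p₂ with length-mono-≤ p₂
...   | s≤s ()
Sublist132-∷ʳ-max⁻ xs M below (a , b , c , p , a<c , c<b) | _ , _ ∷ [] , _ , _ , skip _ ()

Sublist132-max∷⁻ : ∀ M ζ → Above [ M ] ζ → Sublist132 (M ∷ ζ) → Sublist132 ζ
Sublist132-max∷⁻ M ζ above h with Sublist132-split [ M ] ζ above h
... | inj₁ h₁ = ⊥-elim (¬Sublist132-[x] h₁)
... | inj₂ h₂ = h₂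

avoids132⇒Above : ∀ α N β → ¬ Sublist132 (α ++ N ∷ β) → AllBelow N (α ++ β) →
                  (∀ {x y} → x ∈ α → y ∈ β → x ≢ y) → Above α β
avoids132⇒Above α N β avoids below distinct {x} {y} x∈α y∈β with <-cmp x y
... | tri< x<y _ _ = ⊥-elim (avoids (x , N , y , ++⁺ (from∈ x∈α) (refl ∷ from∈ y∈β) , x<y , below (∈-++⁺ʳ α y∈β)))
... | tri≈ _ x≡y _ = ⊥-elim (distinct x∈α y∈β x≡y)
... | tri> _ _ y<x = y<x

data IsEven : ℕ → Set where
  even-0 : IsEven 0
  even-2+ : ∀ {n} → IsEven n → IsEven (suc (suc n))

even-2+⁻ : ∀ {n} → IsEven (suc (suc n)) → IsEven n
even-2+⁻ (even-2+ e) = e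

even-or-odd : ∀ n → IsEven n ⊎ IsEven (suc n)
even-or-odd zero = inj₁ even-0
even-or-odd (suc n) = Sum.swap (Sum.map₁ even-2+ (even-or-odd n))

even⇒¬even-suc : ∀ {n} → IsEven n → ¬ IsEven (suc n)
even⇒¬even-suc (even-2+ e) (even-2+ e′) = even⇒¬even-suc e e′

even-+ : ∀ {m n} → IsEven m → IsEven n → IsEven (m + n)
even-+ even-0 en = en
even-+ (even-2+ em) en = even-2+ (even-+ em en)

even-+⁻ʳ : ∀ {m n} → IsEven m → IsEven (m + n) → IsEven n
even-+⁻ʳ even-0 e = e
even-+⁻ʳ (even-2+ em) (even-2+ e) = even-+⁻ʳ em e

IsEven⇒Even : ∀ {n} → IsEven n → Even n
IsEven⇒Even even-0 = divides 0 refl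
IsEven⇒Even (even-2+ e) with IsEven⇒Even e
... | divides q eq = divides (suc q) (cong (suc ∘ suc) eq)

Even⇒IsEven : ∀ {n} → Even n → IsEven n
Even⇒IsEven (divides q refl) = double q
  where
  double : ∀ q → IsEven (q * 2)
  double zero = even-0
  double (suc q) = even-2+ (double q)

even-suc⇒Odd : ∀ {n} → IsEven (suc n) → Odd n
even-suc⇒Odd es e = even⇒¬even-suc (Even⇒IsEven e) es

Odd⇒even-suc : ∀ {n} → Odd n → IsEven (suc n)
Odd⇒even-suc {n} odd with even-or-odd n
... | inj₁ e = ⊥-elim (odd (IsEven⇒Even e))
... | inj₂ e = e

-- The Dumont condition at an entry x, given the entry after it (`nothing`: x is the last entry).
DumontStep : ℕ → Maybe ℕ → Set
DumontStep x nothing = Odd x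
DumontStep x (just y) = (Even x → y < x) × (Odd x → x < y)

headOr : List ℕ → Maybe ℕ → Maybe ℕ
headOr [] next = next
headOr (y ∷ _) _ = just y

DumontFollowedBy : List ℕ → Maybe ℕ → Set
DumontFollowedBy [] next = ⊤
DumontFollowedBy (x ∷ xs) next = DumontStep x (headOr xs next) × DumontFollowedBy xs next

NextSatisfies : (π : List ℕ) → Fin (length π) → (ℕ → Set) → Set
NextSatisfies π i P = ∃[ j ] (toℕ j ≡ suc (toℕ i) × P (lookup π j))

IsDumontList-step : ∀ {x y ys} → IsDumontList (x ∷ y ∷ ys) → DumontStep x (just y)
IsDumontList-step {x} {y} {ys} d =
  (λ e → second (_< x) (proj₁ (d fzero) e)) , (λ o → [ (λ ()) , second (x <_) ]′ (proj₂ (d fzero) o))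
  where
  second : ∀ (P : ℕ → Set) → NextSatisfies (x ∷ y ∷ ys) fzero P → P y
  second P (fsuc fzero , _ , py) = py

IsDumontList-tail : ∀ {x y ys} → IsDumontList (x ∷ y ∷ ys) → IsDumontList (y ∷ ys)
IsDumontList-tail {x} {y} {ys} d i =
  (λ e → down (_< yᵢ) (proj₁ (d (fsuc i)) e)) , (λ o → Sum.map suc-injective (down (yᵢ <_)) (proj₂ (d (fsuc i)) o))
  where
  yᵢ : ℕ
  yᵢ = lookup (y ∷ ys) i
  down : ∀ (P : ℕ → Set) → NextSatisfies (x ∷ y ∷ ys) (fsuc i) P → NextSatisfies (y ∷ ys) i P
  down P (fsuc j , eq , pj) = j , suc-injective eq , pj

IsDumontList⇒DumontFollowedBy : ∀ π → IsDumontList π → DumontFollowedBy π nothing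
IsDumontList⇒DumontFollowedBy [] _ = tt
IsDumontList⇒DumontFollowedBy (x ∷ []) d = (λ e → noNext (proj₁ (d fzero) e)) , tt
  where
  noNext : ¬ NextSatisfies [ x ] fzero (_< x)
  noNext (fzero , () , _)
IsDumontList⇒DumontFollowedBy (x ∷ y ∷ ys) d =
  IsDumontList-step d , IsDumontList⇒DumontFollowedBy (y ∷ ys) (IsDumontList-tail d)

DumontFollowedBy⇒IsDumontList : ∀ π → DumontFollowedBy π nothing → IsDumontList π
DumontFollowedBy⇒IsDumontList (x ∷ []) (odd , _) fzero = ⊥-elim ∘ odd , λ _ → inj₁ refl
DumontFollowedBy⇒IsDumontList (x ∷ y ∷ ys) ((down , up) , _) fzero =
  (λ e → fsuc fzero , refl , down e) , (λ o → inj₂ (fsuc fzero , refl , up o))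
DumontFollowedBy⇒IsDumontList (x ∷ y ∷ ys) (_ , d) (fsuc i) =
  let down , up = DumontFollowedBy⇒IsDumontList (y ∷ ys) d i in
  (λ e → up-index (_< yᵢ) (down e)) , (λ o → Sum.map (cong suc) (up-index (yᵢ <_)) (up o))
  where
  yᵢ : ℕ
  yᵢ = lookup (y ∷ ys) i
  up-index : ∀ (P : ℕ → Set) → NextSatisfies (y ∷ ys) i P → NextSatisfies (x ∷ y ∷ ys) (fsuc i) P
  up-index P (j , eq , pj) = fsuc j , cong suc eq , pj

headOr-++ : ∀ xs ys next → headOr (xs ++ ys) next ≡ headOr xs (headOr ys next)
headOr-++ [] ys next = refl
headOr-++ (x ∷ xs) ys next = refl

DumontFollowedBy-++⁻ : ∀ xs ys next → DumontFollowedBy (xs ++ ys) next →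
                       DumontFollowedBy xs (headOr ys next) × DumontFollowedBy ys next
DumontFollowedBy-++⁻ [] ys next d = tt , d
DumontFollowedBy-++⁻ (x ∷ xs) ys next (step , d) =
  let d₁ , d₂ = DumontFollowedBy-++⁻ xs ys next d in (subst (DumontStep x) (headOr-++ xs ys next) step , d₁) , d₂

DumontFollowedBy-++⁺ : ∀ xs ys next → DumontFollowedBy xs (headOr ys next) → DumontFollowedBy ys next →
                       DumontFollowedBy (xs ++ ys) next
DumontFollowedBy-++⁺ [] ys next _ d = d
DumontFollowedBy-++⁺ (x ∷ xs) ys next (step , d₁) d₂ =
  subst (DumontStep x) (sym (headOr-++ xs ys next)) step , DumontFollowedBy-++⁺ xs ys next d₁ d₂

DumontStep-at : ∀ u x v next → DumontFollowedBy (u ++ x ∷ v) next → DumontStep x (headOr v next)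
DumontStep-at u x v next d = proj₁ (proj₂ (DumontFollowedBy-++⁻ u (x ∷ v) next d))

DumontFollowedBy-larger⁺ : ∀ xs b → DumontFollowedBy xs nothing → AllBelow b xs → DumontFollowedBy xs (just b)
DumontFollowedBy-larger⁺ [] b _ _ = tt
DumontFollowedBy-larger⁺ (x ∷ []) b (odd , _) below = (⊥-elim ∘ odd , λ _ → below (here refl)) , tt
DumontFollowedBy-larger⁺ (x ∷ y ∷ ys) b (step , d) below =
  step , DumontFollowedBy-larger⁺ (y ∷ ys) b d (below ∘ there)

DumontFollowedBy-larger⁻ : ∀ xs b → DumontFollowedBy xs (just b) → AllBelow b xs → DumontFollowedBy xs nothing
DumontFollowedBy-larger⁻ [] b _ _ = tt
DumontFollowedBy-larger⁻ (x ∷ []) b ((down , _) , _) below = (λ e → <-asym (down e) (below (here refl))) , tt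
DumontFollowedBy-larger⁻ (x ∷ y ∷ ys) b (step , d) below =
  step , DumontFollowedBy-larger⁻ (y ∷ ys) b d (below ∘ there)

DumontStep-even : ∀ {x y} → IsEven x → y < x → DumontStep x (just y)
DumontStep-even ex y<x = (λ _ → y<x) , (λ odd → ⊥-elim (odd (IsEven⇒Even ex)))

DumontStep-odd : ∀ {x y} → IsEven (suc x) → x < y → DumontStep x (just y)
DumontStep-odd ex x<y = (λ e → ⊥-elim (even-suc⇒Odd ex e)) , (λ _ → x<y)

DumontStep-rise⇒Odd : ∀ {x y} → DumontStep x (just y) → x < y → Odd x
DumontStep-rise⇒Odd (down , _) x<y e = <-asym x<y (down e)

interval : ℕ → ℕ → List ℕ
interval a = applyDownFrom (λ i → suc (a + i))

length-interval : ∀ a n → length (interval a n) ≡ n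
length-interval a = length-applyDownFrom _

∈-interval⁻ : ∀ {a n x} → x ∈ interval a n → a < x × x ≤ a + n
∈-interval⁻ {a} {suc n} (here refl) = s≤s (m≤m+n a n) , ≤-reflexive (sym (+-suc a n))
∈-interval⁻ {a} {suc n} (there x∈) =
  let a<x , x≤a+n = ∈-interval⁻ {a} {n} x∈ in a<x , ≤-trans x≤a+n (+-monoʳ-≤ a (n≤1+n n))

∈-interval⁺ : ∀ {a n x} → a < x → x ≤ a + n → x ∈ interval a n
∈-interval⁺ {a} {zero} {x} a<x x≤a = ⊥-elim (<-irrefl refl (<-≤-trans a<x (subst (x ≤_) (+-identityʳ a) x≤a)))
∈-interval⁺ {a} {suc n} {x} a<x x≤ with m≤n⇒m<n∨m≡n (subst (x ≤_) (+-suc a n) x≤)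
... | inj₁ x<top = there (∈-interval⁺ a<x (s≤s⁻¹ x<top))
... | inj₂ x≡top = here x≡top

interval-++ : ∀ a m n → interval a (m + n) ≡ interval (a + n) m ++ interval a n
interval-++ a zero n = refl
interval-++ a (suc m) n =
  cong₂ _∷_ (cong suc (trans (cong (_+_ a) (+-comm m n)) (sym (+-assoc a n m)))) (interval-++ a m n)

upTo↭interval : ∀ n → map suc (upTo n) ↭ interval 0 n
upTo↭interval n = ↭-trans (↭-reflexive (map-upTo suc n))
                          (↭-trans (↭-sym (↭-reverse _)) (↭-reflexive (reverse-applyUpTo suc n)))

↭interval⇒bounds : ∀ {π a n x} → π ↭ interval a n → x ∈ π → a < x × x ≤ a + n
↭interval⇒bounds p = ∈-interval⁻ ∘ ∈-resp-↭ p

↭interval⇒Unique : ∀ {π a n} → π ↭ interval a n → Unique π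
↭interval⇒Unique {a = a} {n} p =
  Unique-resp-↭ (↭⇒↭ₛ (↭-sym p)) (Unique.applyDownFrom⁺₁ _ n (λ j<i _ eq → <⇒≢ j<i (sym (+-cancelˡ-≡ a _ _ (suc-injective eq)))))
  where open Data.List.Relation.Binary.Permutation.Setoid.Properties (setoid ℕ) using (Unique-resp-↭)

↭interval⇒length : ∀ {π a n} → π ↭ interval a n → length π ≡ n
↭interval⇒length {a = a} {n} p = trans (↭-length p) (length-interval a n)

drop-top : ∀ {T : ℕ} xs ys {zs} → xs ++ T ∷ ys ↭ T ∷ zs → xs ++ ys ↭ zs
drop-top xs ys = drop-mid xs []

interval-split-above : ∀ m a xs ys → xs ++ ys ↭ interval a m → Above xs ys →
                       ys ↭ interval a (length ys) × xs ↭ interval (a + length ys) (length xs)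
interval-split-above m a [] ys p _ = subst (λ l → ys ↭ interval a l) (sym (↭interval⇒length p)) p , ↭-refl
interval-split-above zero a (x ∷ xs) ys p _ with ↭-length p
... | ()
interval-split-above (suc m) a xs ys p above with ∈-++⁻ xs (∈-resp-↭ (↭-sym p) (here refl))
... | inj₂ top∈ys = top-in-ys xs p above
  where
  top-in-ys : ∀ xs → xs ++ ys ↭ interval a (suc m) → Above xs ys →
              ys ↭ interval a (length ys) × xs ↭ interval (a + length ys) (length xs)
  top-in-ys [] p _ = interval-split-above (suc m) a [] ys p (λ ())
  top-in-ys (x ∷ xs) p above =
    ⊥-elim (<-irrefl refl (<-≤-trans (above (here refl) top∈ys) (subst (x ≤_) (+-suc a m) (proj₂ (↭interval⇒bounds p (here refl))))))
... | inj₁ top∈xs with ∈-∃++ top∈xs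
... | xs₁ , xs₂ , refl =
  let ys↭ , rest↭ = interval-split-above m a (xs₁ ++ xs₂) ys rest++ys↭ above′
  in ys↭ , ↭-trans (shift T xs₁ xs₂) (subst (λ l → T ∷ xs₁ ++ xs₂ ↭ interval (a + length ys) l) (sym length-xs)
                                         (subst (λ t → T ∷ xs₁ ++ xs₂ ↭ t ∷ interval (a + length ys) l) top≡ (prep T rest↭)))
  where
  T : ℕ
  T = suc (a + m)
  l : ℕ
  l = length (xs₁ ++ xs₂)
  length-xs : length (xs₁ ++ T ∷ xs₂) ≡ suc l
  length-xs = trans (length-++ xs₁) (trans (+-suc (length xs₁) (length xs₂)) (cong suc (sym (length-++ xs₁))))
  rest++ys↭ : (xs₁ ++ xs₂) ++ ys ↭ interval a m
  rest++ys↭ = subst (_↭ interval a m) (sym (++-assoc xs₁ xs₂ ys))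
                    (drop-top xs₁ (xs₂ ++ ys) (subst (_↭ interval a (suc m)) (++-assoc xs₁ (T ∷ xs₂) ys) p))
  above′ : Above (xs₁ ++ xs₂) ys
  above′ x∈ = above (∈-insert-top x∈)
    where
    ∈-insert-top : ∀ {x} → x ∈ xs₁ ++ xs₂ → x ∈ xs₁ ++ T ∷ xs₂
    ∈-insert-top x∈ with ∈-++⁻ xs₁ x∈
    ... | inj₁ x∈₁ = ∈-++⁺ˡ x∈₁
    ... | inj₂ x∈₂ = ∈-++⁺ʳ xs₁ (there x∈₂)
  m≡ : m ≡ l + length ys
  m≡ = trans (sym (↭interval⇒length rest++ys↭)) (length-++ (xs₁ ++ xs₂))
  top≡ : T ≡ suc (a + length ys + l)
  top≡ = cong suc (trans (cong (_+_ a) (trans m≡ (+-comm l (length ys)))) (sym (+-assoc a (length ys) l)))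

concatUpTo : {X : Set} → (ℕ → List X) → ℕ → List X
concatUpTo h zero = h zero
concatUpTo h (suc n) = concatUpTo h n ++ h (suc n)

closeWith : ℕ → List ℕ → List ℕ → List ℕ
closeWith c γ σ = σ ++ suc (suc c) ∷ (γ ∷ʳ suc c)

block : ℕ → List ℕ → List ℕ
block c α = α ++ c ∷ suc c ∷ []

-- The first argument is fuel; the lists are complete once it exceeds the length n.
mutual
  qPerms : ℕ → ℕ → ℕ → ℕ → List (List ℕ)
  qPerms zero a k n = []
  qPerms (suc f) a zero n = []
  qPerms (suc f) a (suc k) zero = [ [] ]
  qPerms (suc f) a (suc k) (suc zero) = []
  qPerms (suc f) a (suc zero) (suc (suc m)) = []
  qPerms (suc f) a (suc (suc k)) (suc (suc m)) =
    concatUpTo (λ i → cartesianProductWith (closeWith (a + i)) (qPerms f a (suc k) i) (iPerms f (suc (suc (a + i))) k (m ∸ i))) m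

  iPerms : ℕ → ℕ → ℕ → ℕ → List (List ℕ)
  iPerms zero a k n = []
  iPerms (suc f) a k zero = [ [] ]
  iPerms (suc f) a k (suc n) =
    concatUpTo (λ i → cartesianProductWith _++_ (iBlocks f a k n i) (iPerms f a k (suc n ∸ i))) (suc n)

  iBlocks : ℕ → ℕ → ℕ → ℕ → ℕ → List (List ℕ)
  iBlocks f a k n zero = []
  iBlocks f a k n (suc zero) = []
  iBlocks f a k n (suc (suc j)) = map (block (a + n)) (qPerms f (a + (n ∸ suc j)) k j)

length-cartesianProductWith : {A B C : Set} (g : A → B → C) (xs : List A) (ys : List B) →
                              length (cartesianProductWith g xs ys) ≡ length xs * length ys
length-cartesianProductWith g [] ys = refl
length-cartesianProductWith g (x ∷ xs) ys =
  trans (length-++ (map (g x) ys)) (cong₂ _+_ (length-map (g x) ys) (length-cartesianProductWith g xs ys))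

+length-cartesianProductWith : {A B C : Set} (g : A → B → C) (xs : List A) (ys : List B) →
                               + length (cartesianProductWith g xs ys) ≡ + length xs ℤ.* + length ys
+length-cartesianProductWith g xs ys =
  trans (cong +_ (length-cartesianProductWith g xs ys)) (ℤ.pos-* (length xs) (length ys))

+length-concatUpTo : {X : Set} (h : ℕ → List X) → ∀ n → + length (concatUpTo h n) ≡ sumTo (λ i → + length (h i)) n
+length-concatUpTo h zero = refl
+length-concatUpTo h (suc n) =
  trans (cong +_ (length-++ (concatUpTo h n)))
        (trans (ℤ.pos-+ (length (concatUpTo h n)) (length (h (suc n)))) (cong (ℤ._+ + length (h (suc n))) (+length-concatUpTo h n)))

sumTo-cong : ∀ {f g : ℕ → ℤ} n → (∀ i → i ≤ n → f i ≡ g i) → sumTo f n ≡ sumTo g n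
sumTo-cong zero eq = eq 0 z≤n
sumTo-cong (suc n) eq = cong₂ ℤ._+_ (sumTo-cong n (λ i i≤n → eq i (m≤n⇒m≤1+n i≤n))) (eq (suc n) ≤-refl)

sumTo-difference : ∀ (f g : ℕ → ℤ) n → sumTo (λ i → f i ℤ.- g i) n ≡ sumTo f n ℤ.- sumTo g n
sumTo-difference f g zero = refl
sumTo-difference f g (suc n) = trans (cong (ℤ._+ (f (suc n) ℤ.- g (suc n))) (sumTo-difference f g n)) (regroup (sumTo f n) (sumTo g n) (f (suc n)) (g (suc n)))
  where
  regroup : ∀ a b c d → (a ℤ.- b) ℤ.+ (c ℤ.- d) ≡ (a ℤ.+ c) ℤ.- (b ℤ.+ d)
  regroup = ℤ-solve-∀

sumTo-1ˢ* : ∀ (g : ℕ → ℤ) n → sumTo (λ i → 1ˢ i ℤ.* g i) n ≡ g 0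
sumTo-1ˢ* g zero = ℤ.*-identityˡ (g 0)
sumTo-1ˢ* g (suc n) = trans (cong (ℤ._+ ℤ.0ℤ) (sumTo-1ˢ* g n)) (ℤ.+-identityʳ (g 0))

oddPart : ℕ → ℕ → List (List ℕ)
oddPart k zero = []
oddPart k (suc m) = map (_∷ʳ suc m) (qPerms (suc m) 0 k m)

avoiders : ℕ → ℕ → List (List ℕ)
avoiders k n = qPerms (suc n) 0 (suc k) n ++ oddPart k n

module Counting (Q I : ℕ → Series)
  (Q0 : Q 0 ≈ˢ 0ˢ) (Q1 : Q 1 ≈ˢ 1ˢ)
  (I-inverse : (r : ℕ) → ((1ˢ -ˢ x²ˢ (Q r)) *ˢ I r) ≈ˢ 1ˢ)
  (Q-rec : (r : ℕ) → 2 ≤ r → Q r ≈ˢ (1ˢ +ˢ x²ˢ (Q (r ∸ 1) *ˢ I (r ∸ 2)))) where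

  I-rec : ∀ r n → I r n ≡ 1ˢ n ℤ.+ (x²ˢ (Q r) *ˢ I r) n
  I-rec r n = begin
    I r n                        ≡⟨ solve-∀′ (I r n) S ⟩
    (I r n ℤ.- S) ℤ.+ S          ≡⟨ cong (ℤ._+ S) I-S ⟩
    1ˢ n ℤ.+ S                   ∎
    where
    open ≡-Reasoning
    S : ℤ
    S = (x²ˢ (Q r) *ˢ I r) n
    solve-∀′ : ∀ a b → a ≡ (a ℤ.- b) ℤ.+ b
    solve-∀′ = ℤ-solve-∀
    distrib : ∀ a b c → (a ℤ.- b) ℤ.* c ≡ a ℤ.* c ℤ.- b ℤ.* c
    distrib = ℤ-solve-∀
    I-S : I r n ℤ.- S ≡ 1ˢ n
    I-S = begin
      I r n ℤ.- S
        ≡⟨ cong (ℤ._- S) (sym (sumTo-1ˢ* (λ i → I r (n ∸ i)) n)) ⟩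
      sumTo (λ i → 1ˢ i ℤ.* I r (n ∸ i)) n ℤ.- S
        ≡⟨ sym (sumTo-difference _ _ n) ⟩
      sumTo (λ i → 1ˢ i ℤ.* I r (n ∸ i) ℤ.- x²ˢ (Q r) i ℤ.* I r (n ∸ i)) n
        ≡⟨ sumTo-cong n (λ i _ → sym (distrib (1ˢ i) (x²ˢ (Q r) i) (I r (n ∸ i)))) ⟩
      ((1ˢ -ˢ x²ˢ (Q r)) *ˢ I r) n
        ≡⟨ I-inverse r n ⟩
      1ˢ n ∎

  mutual
    length-qPerms : ∀ f a k n → n < f → + length (qPerms f a k n) ≡ Q k n
    length-qPerms (suc f) a zero n _ = sym (Q0 n)
    length-qPerms (suc f) a (suc zero) zero _ = sym (Q1 0)
    length-qPerms (suc f) a (suc (suc k)) zero _ = sym (Q-rec (suc (suc k)) (s≤s (s≤s z≤n)) 0)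
    length-qPerms (suc f) a (suc zero) (suc zero) _ = sym (Q1 1)
    length-qPerms (suc f) a (suc (suc k)) (suc zero) _ = sym (Q-rec (suc (suc k)) (s≤s (s≤s z≤n)) 1)
    length-qPerms (suc f) a (suc zero) (suc (suc m)) _ = sym (Q1 (suc (suc m)))
    length-qPerms (suc f) a (suc (suc k)) (suc (suc m)) m+2≤f = begin
      + length (qPerms (suc f) a (suc (suc k)) (suc (suc m)))
        ≡⟨ +length-concatUpTo _ m ⟩
      sumTo (λ i → + length (cartesianProductWith (closeWith (a + i)) (qPerms f a (suc k) i) (iPerms f (suc (suc (a + i))) k (m ∸ i)))) m
        ≡⟨ sumTo-cong m term ⟩
      (Q (suc k) *ˢ I k) m
        ≡⟨ sym (trans (Q-rec (suc (suc k)) (s≤s (s≤s z≤n)) (suc (suc m))) (ℤ.+-identityˡ _)) ⟩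
      Q (suc (suc k)) (suc (suc m)) ∎
      where
      open ≡-Reasoning
      m<f : m < f
      m<f = ≤-trans (n≤1+n (suc m)) (s≤s⁻¹ m+2≤f)
      term : ∀ i → i ≤ m →
             + length (cartesianProductWith (closeWith (a + i)) (qPerms f a (suc k) i) (iPerms f (suc (suc (a + i))) k (m ∸ i)))
             ≡ Q (suc k) i ℤ.* I k (m ∸ i)
      term i i≤m = trans (+length-cartesianProductWith (closeWith (a + i)) (qPerms f a (suc k) i) (iPerms f (suc (suc (a + i))) k (m ∸ i)))
        (cong₂ ℤ._*_ (length-qPerms f a (suc k) i (≤-<-trans i≤m m<f))
                     (length-iPerms f (suc (suc (a + i))) k (m ∸ i) (≤-<-trans (m∸n≤m m i) m<f)))

    length-iPerms : ∀ f a k n → n < f → + length (iPerms f a k n) ≡ I k n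
    length-iPerms (suc f) a k zero _ = sym (I-rec k 0)
    length-iPerms (suc f) a k (suc n) n+1≤f = begin
      + length (iPerms (suc f) a k (suc n))
        ≡⟨ +length-concatUpTo _ (suc n) ⟩
      sumTo (λ i → + length (cartesianProductWith _++_ (iBlocks f a k n i) (iPerms f a k (suc n ∸ i)))) (suc n)
        ≡⟨ sumTo-cong (suc n) term ⟩
      (x²ˢ (Q k) *ˢ I k) (suc n)
        ≡⟨ sym (trans (I-rec k (suc n)) (ℤ.+-identityˡ _)) ⟩
      I k (suc n) ∎
      where
      open ≡-Reasoning
      term : ∀ i → i ≤ suc n →
             + length (cartesianProductWith _++_ (iBlocks f a k n i) (iPerms f a k (suc n ∸ i))) ≡ x²ˢ (Q k) i ℤ.* I k (suc n ∸ i)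
      term zero _ = refl
      term (suc zero) _ = refl
      term (suc (suc j)) j+2≤n+1 = begin
        + length (cartesianProductWith _++_ (map (block (a + n)) (qPerms f (a + (n ∸ suc j)) k j)) (iPerms f a k (n ∸ suc j)))
          ≡⟨ trans (+length-cartesianProductWith _++_ (map (block (a + n)) Qs) Is) (cong (λ l → + l ℤ.* + length Is) (length-map (block (a + n)) Qs)) ⟩
        + length (qPerms f (a + (n ∸ suc j)) k j) ℤ.* + length (iPerms f a k (n ∸ suc j))
          ≡⟨ cong₂ ℤ._*_ (length-qPerms f _ k j (≤-trans (n≤1+n (suc j)) (≤-trans j+2≤n+1 (s≤s⁻¹ n+1≤f))))
                         (length-iPerms f a k (n ∸ suc j) (≤-<-trans (m∸n≤m n (suc j)) (s≤s⁻¹ n+1≤f))) ⟩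
        Q k j ℤ.* I k (n ∸ suc j) ∎
        where
        Qs : List (List ℕ)
        Qs = qPerms f (a + (n ∸ suc j)) k j
        Is : List (List ℕ)
        Is = iPerms f a k (n ∸ suc j)

  length-oddPart : ∀ k n → + length (oddPart k n) ≡ xˢ (Q k) n
  length-oddPart k zero = refl
  length-oddPart k (suc m) = trans (cong +_ (length-map (_∷ʳ suc m) (qPerms (suc m) 0 k m))) (length-qPerms (suc m) 0 k m ≤-refl)

  length-avoiders : ∀ k n → + length (avoiders k n) ≡ (Q (suc k) +ˢ xˢ (Q k)) n
  length-avoiders k n =
    trans (cong +_ (length-++ (qPerms (suc n) 0 (suc k) n)))
          (trans (ℤ.pos-+ (length (qPerms (suc n) 0 (suc k) n)) _)
                 (cong₂ ℤ._+_ (length-qPerms (suc n) 0 (suc k) n ≤-refl) (length-oddPart k n)))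

∈-concatUpTo⁻ : ∀ {X : Set} (h : ℕ → List X) n {z} → z ∈ concatUpTo h n → ∃[ i ] (i ≤ n × z ∈ h i)
∈-concatUpTo⁻ h zero z∈ = 0 , z≤n , z∈
∈-concatUpTo⁻ h (suc n) z∈ with ∈-++⁻ (concatUpTo h n) z∈
... | inj₁ z∈′ = let i , i≤n , z∈hi = ∈-concatUpTo⁻ h n z∈′ in i , m≤n⇒m≤1+n i≤n , z∈hi
... | inj₂ z∈′ = suc n , ≤-refl , z∈′

∈-concatUpTo⁺ : ∀ {X : Set} (h : ℕ → List X) {n i z} → i ≤ n → z ∈ h i → z ∈ concatUpTo h n
∈-concatUpTo⁺ h {zero} z≤n z∈ = z∈
∈-concatUpTo⁺ h {suc n} i≤ z∈ with m≤n⇒m<n∨m≡n i≤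
... | inj₁ i<1+n = ∈-++⁺ˡ (∈-concatUpTo⁺ h (s≤s⁻¹ i<1+n) z∈)
... | inj₂ refl = ∈-++⁺ʳ (concatUpTo h n) z∈

Unique-concatUpTo : ∀ {X : Set} (h : ℕ → List X) n → (∀ i → i ≤ n → Unique (h i)) →
                    (∀ {i i′ z} → i ≤ n → i′ ≤ n → z ∈ h i → z ∈ h i′ → i ≡ i′) → Unique (concatUpTo h n)
Unique-concatUpTo h zero unique _ = unique 0 z≤n
Unique-concatUpTo h (suc n) unique sameIndex =
  Unique.++⁺ (Unique-concatUpTo h n (λ i i≤n → unique i (m≤n⇒m≤1+n i≤n))
                                    (λ i≤n i′≤n → sameIndex (m≤n⇒m≤1+n i≤n) (m≤n⇒m≤1+n i′≤n)))
             (unique (suc n) ≤-refl) disjoint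
  where
  disjoint : ∀ {z} → z ∈ concatUpTo h n × z ∈ h (suc n) → ⊥
  disjoint (z∈ , z∈′) with ∈-concatUpTo⁻ h n z∈
  ... | i , i≤n , z∈hi = <-irrefl (sameIndex (m≤n⇒m≤1+n i≤n) ≤-refl z∈hi z∈′) (s≤s i≤n)

Unique-map : ∀ {A C : Set} (g : A → C) {ys} → Unique ys →
             (∀ {y y′} → y ∈ ys → y′ ∈ ys → g y ≡ g y′ → y ≡ y′) → Unique (map g ys)
Unique-map g [] inj = []
Unique-map g {y ∷ ys} (y∉ ∷ unique) inj =
  All.tabulate distinct ∷ Unique-map g unique (λ y∈ y′∈ → inj (there y∈) (there y′∈))
  where
  distinct : ∀ {z} → z ∈ map g ys → g y ≢ z
  distinct z∈ eq with ∈-map⁻ g z∈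
  ... | y′ , y′∈ , refl = All.lookup y∉ y′∈ (inj (here refl) (there y′∈) eq)

Unique-cartesianProductWith : ∀ {A B C : Set} (g : A → B → C) {xs ys} → Unique xs → Unique ys →
  (∀ {x x′ y y′} → x ∈ xs → x′ ∈ xs → y ∈ ys → y′ ∈ ys → g x y ≡ g x′ y′ → x ≡ x′ × y ≡ y′) →
  Unique (cartesianProductWith g xs ys)
Unique-cartesianProductWith g [] _ _ = []
Unique-cartesianProductWith g {x ∷ xs} {ys} (x∉ ∷ uxs) uys inj =
  Unique.++⁺ (Unique-map (g x) uys (λ y∈ y′∈ eq → proj₂ (inj (here refl) (here refl) y∈ y′∈ eq)))
             (Unique-cartesianProductWith g uxs uys (λ x∈ x′∈ → inj (there x∈) (there x′∈)))
             disjoint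
  where
  disjoint : ∀ {z} → z ∈ map (g x) ys × z ∈ cartesianProductWith g xs ys → ⊥
  disjoint (z∈ , z∈′) with ∈-map⁻ (g x) z∈ | ∈-cartesianProductWith⁻ g xs ys z∈′
  ... | y , y∈ , refl | x′ , y′ , x′∈ , y′∈ , eq =
    All.lookup x∉ x′∈ (proj₁ (inj (here refl) (there x′∈) y∈ y′∈ eq))

++-injective-length : ∀ {A : Set} (xs xs′ : List A) {ys ys′} → length xs ≡ length xs′ →
                      xs ++ ys ≡ xs′ ++ ys′ → xs ≡ xs′ × ys ≡ ys′
++-injective-length [] [] _ eq = refl , eq
++-injective-length (x ∷ xs) (x′ ∷ xs′) len eq with ∷-injective eq
... | refl , eq′ with ++-injective-length xs xs′ (suc-injective len) eq′
... | refl , eq″ = refl , eq″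

++-injective-∉ : ∀ (xs xs′ : List ℕ) {d ys ys′} → d ∉ xs → d ∉ xs′ →
                 xs ++ d ∷ ys ≡ xs′ ++ d ∷ ys′ → xs ≡ xs′ × ys ≡ ys′
++-injective-∉ [] [] _ _ refl = refl , refl
++-injective-∉ [] (x′ ∷ xs′) _ d∉′ eq = ⊥-elim (d∉′ (here (proj₁ (∷-injective eq))))
++-injective-∉ (x ∷ xs) [] d∉ _ eq = ⊥-elim (d∉ (here (sym (proj₁ (∷-injective eq)))))
++-injective-∉ (x ∷ xs) (x′ ∷ xs′) d∉ d∉′ eq with ∷-injective eq
... | refl , eq′ with ++-injective-∉ xs xs′ (d∉ ∘ there) (d∉′ ∘ there) eq′
... | refl , eq″ = refl , eq″

∈-qPerms⁻ : ∀ f a k m {π} → π ∈ qPerms (suc f) a (suc (suc k)) (suc (suc m)) →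
            ∃[ i ] ∃[ r ] ∃[ γ ] ∃[ σ ] (m ≡ i + r × γ ∈ qPerms f a (suc k) i ×
                                        σ ∈ iPerms f (suc (suc (a + i))) k r × π ≡ closeWith (a + i) γ σ)
∈-qPerms⁻ f a k m π∈ with ∈-concatUpTo⁻ _ m π∈
... | i , i≤m , π∈′ with ∈-cartesianProductWith⁻ (closeWith (a + i)) (qPerms f a (suc k) i) _ π∈′
... | γ , σ , γ∈ , σ∈ , π≡ = i , m ∸ i , γ , σ , sym (m+[n∸m]≡n i≤m) , γ∈ , σ∈ , π≡

∈-qPerms⁺ : ∀ f a k {i r γ σ} → γ ∈ qPerms f a (suc k) i → σ ∈ iPerms f (suc (suc (a + i))) k r →
            closeWith (a + i) γ σ ∈ qPerms (suc f) a (suc (suc k)) (suc (suc (i + r)))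
∈-qPerms⁺ f a k {i} {r} γ∈ σ∈ =
  ∈-concatUpTo⁺ _ (m≤m+n i r)
    (∈-cartesianProductWith⁺ (closeWith (a + i)) γ∈ (subst (λ l → _ ∈ iPerms f _ k l) (sym (m+n∸m≡n i r)) σ∈))

∈-iBlocks⁻ : ∀ f a k n i {b} → b ∈ iBlocks f a k n i →
             ∃[ j ] ∃[ α ] (i ≡ suc (suc j) × α ∈ qPerms f (a + (n ∸ suc j)) k j × b ≡ block (a + n) α)
∈-iBlocks⁻ f a k n (suc (suc j)) b∈ with ∈-map⁻ (block (a + n)) b∈
... | α , α∈ , b≡ = j , α , refl , α∈ , b≡

block-top : ∀ a j b → a + suc (j + b) ≡ suc (a + b + j)
block-top = solve-∀

∈-iPerms⁻ : ∀ f a k n {π} → π ∈ iPerms (suc f) a k (suc n) →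
            ∃[ j ] ∃[ b ] ∃[ α ] ∃[ ρ ] (n ≡ suc (j + b) × α ∈ qPerms f (a + b) k j × ρ ∈ iPerms f a k b ×
                                        π ≡ block (suc (a + b + j)) α ++ ρ)
∈-iPerms⁻ f a k n π∈ with ∈-concatUpTo⁻ _ (suc n) π∈
... | i , i≤ , π∈′ with ∈-cartesianProductWith⁻ _++_ (iBlocks f a k n i) (iPerms f a k (suc n ∸ i)) π∈′
... | _ , ρ , b∈ , ρ∈ , refl with ∈-iBlocks⁻ f a k n i b∈
... | j , α , refl , α∈ , refl =
  j , n ∸ suc j , α , ρ , n≡ , α∈ , ρ∈ , cong (λ c → block c α ++ ρ) (trans (cong (_+_ a) n≡) (block-top a j _))
  where
  n≡ : n ≡ suc (j + (n ∸ suc j))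
  n≡ = sym (m+[n∸m]≡n (s≤s⁻¹ i≤))

∈-iPerms⁺ : ∀ f a k {j b α ρ} → α ∈ qPerms f (a + b) k j → ρ ∈ iPerms f a k b →
            block (suc (a + b + j)) α ++ ρ ∈ iPerms (suc f) a k (suc (suc (j + b)))
∈-iPerms⁺ f a k {j} {b} {α} {ρ} α∈ ρ∈ =
  subst (λ c → block c α ++ ρ ∈ iPerms (suc f) a k (suc (suc (j + b)))) (block-top a j b)
    (∈-concatUpTo⁺ _ (s≤s (s≤s (m≤m+n j b)))
      (∈-cartesianProductWith⁺ _++_ (∈-map⁺ (block (a + suc (j + b))) (subst (λ l → α ∈ qPerms f (a + l) k j) (sym b≡) α∈))
                                    (subst (λ l → ρ ∈ iPerms f a k l) (sym b≡) ρ∈)))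
  where
  b≡ : j + b ∸ j ≡ b
  b≡ = m+n∸m≡n j b

++-↭interval : ∀ {σ τ a m n} → σ ↭ interval (a + n) m → τ ↭ interval a n → σ ++ τ ↭ interval a (m + n)
++-↭interval {σ} {τ} {a} {m} {n} σ↭ τ↭ = subst (σ ++ τ ↭_) (sym (interval-++ a m n)) (↭.++⁺ σ↭ τ↭)

closing-↭ : ∀ {a i γ} → γ ↭ interval a i → suc (suc (a + i)) ∷ (γ ∷ʳ suc (a + i)) ↭ interval a (suc (suc i))
closing-↭ {a} {i} {γ} γ↭ =
  ↭-trans (prep M (↭-sym (∷↭∷ʳ L γ)))
          (subst (λ t → M ∷ L ∷ γ ↭ t ∷ L ∷ interval a i) (cong suc (sym (+-suc a i))) (prep M (prep L γ↭)))
  where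
  M : ℕ
  M = suc (suc (a + i))
  L : ℕ
  L = suc (a + i)

closeWith-↭ : ∀ {a i r γ σ} → γ ↭ interval a i → σ ↭ interval (suc (suc (a + i))) r →
              closeWith (a + i) γ σ ↭ interval a (suc (suc (i + r)))
closeWith-↭ {a} {i} {r} {γ} {σ} γ↭ σ↭ =
  subst (λ l → closeWith (a + i) γ σ ↭ interval a l) (size r i)
        (++-↭interval (subst (λ o → σ ↭ interval o r) (offset a i) σ↭) (closing-↭ γ↭))
  where
  offset : ∀ a i → suc (suc (a + i)) ≡ a + suc (suc i)
  offset = solve-∀
  size : ∀ r i → r + suc (suc i) ≡ suc (suc (i + r))
  size = solve-∀

block-↭ : ∀ {o j α} → α ↭ interval o j → block (suc (o + j)) α ↭ interval o (suc (suc j))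
block-↭ {o} {j} {α} α↭ =
  ↭-trans (++-comm α _) (↭-trans (swap _ _ ↭-refl)
    (subst (λ t → suc (suc (o + j)) ∷ suc (o + j) ∷ α ↭ t ∷ suc (o + j) ∷ interval o j)
           (cong suc (sym (+-suc o j))) (prep _ (prep _ α↭))))

block++-↭ : ∀ {a b j α ρ} → α ↭ interval (a + b) j → ρ ↭ interval a b →
            block (suc (a + b + j)) α ++ ρ ↭ interval a (suc (suc (j + b)))
block++-↭ α↭ ρ↭ = ++-↭interval (block-↭ α↭) ρ↭

mutual
  qPerms-↭ : ∀ f a k n {π} → π ∈ qPerms f a k n → π ↭ interval a n
  qPerms-↭ (suc f) a (suc k) zero (here refl) = ↭-refl
  qPerms-↭ (suc f) a (suc (suc k)) (suc (suc m)) π∈ with ∈-qPerms⁻ f a k m π∈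
  ... | i , r , γ , σ , refl , γ∈ , σ∈ , refl = closeWith-↭ (qPerms-↭ f a (suc k) i γ∈) (iPerms-↭ f _ k r σ∈)

  iPerms-↭ : ∀ f a k n {π} → π ∈ iPerms f a k n → π ↭ interval a n
  iPerms-↭ (suc f) a k zero (here refl) = ↭-refl
  iPerms-↭ (suc f) a k (suc n) π∈ with ∈-iPerms⁻ f a k n π∈
  ... | j , b , α , ρ , refl , α∈ , ρ∈ , refl = block++-↭ (qPerms-↭ f _ k j α∈) (iPerms-↭ f a k b ρ∈)

closeWith-∷ʳ : ∀ c γ σ → closeWith c γ σ ≡ (σ ++ suc (suc c) ∷ γ) ∷ʳ suc c
closeWith-∷ʳ c γ σ = sym (++-assoc σ (suc (suc c) ∷ γ) [ suc c ])

block-∷ʳ : ∀ c α → block c α ≡ (α ∷ʳ c) ∷ʳ suc c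
block-∷ʳ c α = sym (++-assoc α [ c ] [ suc c ])

iBlocks-shape : ∀ f a k n i {b} → i ≤ suc n → b ∈ iBlocks f a k n i →
                ∃[ xs ] (b ≡ xs ∷ʳ suc (a + n) × suc (a + n) ∉ xs × length b ≡ i)
iBlocks-shape f a k n i i≤ b∈ with ∈-iBlocks⁻ f a k n i b∈
... | j , α , refl , α∈ , refl = α ∷ʳ (a + n) , block-∷ʳ (a + n) α , top∉ , length-block
  where
  α↭ : α ↭ interval (a + (n ∸ suc j)) j
  α↭ = qPerms-↭ f _ k j α∈
  α≤ : ∀ {x} → x ∈ α → x ≤ a + n
  α≤ x∈ = ≤-trans (proj₂ (↭interval⇒bounds α↭ x∈))
                  (≤-trans (≤-reflexive (+-assoc a (n ∸ suc j) j))
                           (+-monoʳ-≤ a (≤-trans (+-monoʳ-≤ (n ∸ suc j) (n≤1+n j)) (≤-reflexive (m∸n+n≡m (s≤s⁻¹ i≤))))))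
  top∉ : suc (a + n) ∉ α ∷ʳ (a + n)
  top∉ x∈ with ∈-++⁻ α x∈
  ... | inj₁ x∈α = <-irrefl refl (α≤ x∈α)
  ... | inj₂ (here eq) = <-irrefl (sym eq) ≤-refl
  length-block : length (block (a + n) α) ≡ suc (suc j)
  length-block = trans (length-++ α) (trans (+-comm (length α) 2) (cong (suc ∘ suc) (↭interval⇒length α↭)))

mutual
  qPerms-unique : ∀ f a k n → Unique (qPerms f a k n)
  qPerms-unique zero a k n = []
  qPerms-unique (suc f) a zero n = []
  qPerms-unique (suc f) a (suc k) zero = [] ∷ []
  qPerms-unique (suc f) a (suc k) (suc zero) = []
  qPerms-unique (suc f) a (suc zero) (suc (suc m)) = []
  qPerms-unique (suc f) a (suc (suc k)) (suc (suc m)) = Unique-concatUpTo _ m (λ i _ → unique i) sameIndex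
    where
    γs : ℕ → List (List ℕ)
    γs i = qPerms f a (suc k) i
    σs : ℕ → List (List ℕ)
    σs i = iPerms f (suc (suc (a + i))) k (m ∸ i)
    unique : ∀ i → Unique (cartesianProductWith (closeWith (a + i)) (γs i) (σs i))
    unique i = Unique-cartesianProductWith _ (qPerms-unique f a (suc k) i) (iPerms-unique f _ k (m ∸ i)) inj
      where
      inj : ∀ {γ γ′ σ σ′} → γ ∈ γs i → γ′ ∈ γs i → σ ∈ σs i → σ′ ∈ σs i →
            closeWith (a + i) γ σ ≡ closeWith (a + i) γ′ σ′ → γ ≡ γ′ × σ ≡ σ′
      inj {γ} {γ′} {σ} {σ′} _ _ σ∈ σ′∈ eq
        with ++-injective-length σ σ′ (trans (↭interval⇒length (iPerms-↭ f _ k _ σ∈))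
                                             (sym (↭interval⇒length (iPerms-↭ f _ k _ σ′∈)))) eq
      ... | refl , eq′ = ∷ʳ-injectiveˡ γ γ′ (proj₂ (∷-injective eq′)) , refl
    sameIndex : ∀ {i i′ z} → i ≤ m → i′ ≤ m → z ∈ cartesianProductWith (closeWith (a + i)) (γs i) (σs i) →
                z ∈ cartesianProductWith (closeWith (a + i′)) (γs i′) (σs i′) → i ≡ i′
    sameIndex {i} {i′} _ _ z∈ z∈′
      with ∈-cartesianProductWith⁻ (closeWith (a + i)) (γs i) (σs i) z∈
         | ∈-cartesianProductWith⁻ (closeWith (a + i′)) (γs i′) (σs i′) z∈′
    ... | γ , σ , _ , _ , refl | γ′ , σ′ , _ , _ , eq =
      +-cancelˡ-≡ a i i′ (suc-injective (∷ʳ-injectiveʳ (σ ++ _ ∷ γ) (σ′ ++ _ ∷ γ′)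
        (trans (sym (closeWith-∷ʳ (a + i) γ σ)) (trans eq (closeWith-∷ʳ (a + i′) γ′ σ′)))))

  iPerms-unique : ∀ f a k n → Unique (iPerms f a k n)
  iPerms-unique zero a k n = []
  iPerms-unique (suc f) a k zero = [] ∷ []
  iPerms-unique (suc f) a k (suc n) = Unique-concatUpTo _ (suc n) unique sameIndex
    where
    blocks : ℕ → List (List ℕ)
    blocks = iBlocks f a k n
    rests : ℕ → List (List ℕ)
    rests i = iPerms f a k (suc n ∸ i)
    blocks-unique : ∀ i → Unique (blocks i)
    blocks-unique zero = []
    blocks-unique (suc zero) = []
    blocks-unique (suc (suc j)) = Unique.map⁺ (++-cancelʳ _ _ _) (qPerms-unique f _ k j)
    unique : ∀ i → i ≤ suc n → Unique (cartesianProductWith _++_ (blocks i) (rests i))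
    unique i i≤ = Unique-cartesianProductWith _++_ (blocks-unique i) (iPerms-unique f a k (suc n ∸ i)) inj
      where
      inj : ∀ {b b′ ρ ρ′} → b ∈ blocks i → b′ ∈ blocks i → ρ ∈ rests i → ρ′ ∈ rests i → b ++ ρ ≡ b′ ++ ρ′ → b ≡ b′ × ρ ≡ ρ′
      inj {b} {b′} b∈ b′∈ _ _ =
        ++-injective-length b b′ (trans (proj₂ (proj₂ (proj₂ (iBlocks-shape f a k n i i≤ b∈))))
                                        (sym (proj₂ (proj₂ (proj₂ (iBlocks-shape f a k n i i≤ b′∈))))))
    sameIndex : ∀ {i i′ z} → i ≤ suc n → i′ ≤ suc n → z ∈ cartesianProductWith _++_ (blocks i) (rests i) →
                z ∈ cartesianProductWith _++_ (blocks i′) (rests i′) → i ≡ i′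
    sameIndex {i} {i′} i≤ i′≤ z∈ z∈′
      with ∈-cartesianProductWith⁻ _++_ (blocks i) (rests i) z∈ | ∈-cartesianProductWith⁻ _++_ (blocks i′) (rests i′) z∈′
    ... | b , ρ , b∈ , _ , refl | b′ , ρ′ , b′∈ , _ , eq
      with iBlocks-shape f a k n i i≤ b∈ | iBlocks-shape f a k n i′ i′≤ b′∈
    ... | xs , refl , top∉ , len | xs′ , refl , top∉′ , len′
      with ++-injective-∉ xs xs′ top∉ top∉′ (trans (sym (++-assoc xs _ ρ)) (trans eq (++-assoc xs′ _ ρ′)))
    ... | refl , _ = trans (sym len) len′

mutual
  qPerms-even : ∀ f a k n {π} → π ∈ qPerms f a k n → IsEven n
  qPerms-even (suc f) a (suc k) zero _ = even-0
  qPerms-even (suc f) a (suc (suc k)) (suc (suc m)) π∈ with ∈-qPerms⁻ f a k m π∈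
  ... | i , r , _ , _ , refl , γ∈ , σ∈ , _ = even-2+ (even-+ (qPerms-even f a (suc k) i γ∈) (iPerms-even f _ k r σ∈))

  iPerms-even : ∀ f a k n {π} → π ∈ iPerms f a k n → IsEven n
  iPerms-even (suc f) a k zero _ = even-0
  iPerms-even (suc f) a k (suc n) π∈ with ∈-iPerms⁻ f a k n π∈
  ... | j , b , _ , _ , refl , α∈ , ρ∈ , _ = even-2+ (even-+ (qPerms-even f _ k j α∈) (iPerms-even f a k b ρ∈))

qPerms-oddPart-disjoint : ∀ k n {π} → π ∈ qPerms (suc n) 0 (suc k) n → π ∉ oddPart k n
qPerms-oddPart-disjoint k (suc m) π∈ π∈′ with ∈-map⁻ (_∷ʳ suc m) π∈′
... | α , α∈ , refl = even⇒¬even-suc (qPerms-even (suc m) 0 k m α∈) (qPerms-even (suc (suc m)) 0 (suc k) (suc m) π∈)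

avoiders-unique : ∀ k n → Unique (avoiders k n)
avoiders-unique k n =
  Unique.++⁺ (qPerms-unique (suc n) 0 (suc k) n) (oddPart-unique n) (λ (π∈ , π∈′) → qPerms-oddPart-disjoint k n π∈ π∈′)
  where
  oddPart-unique : ∀ n → Unique (oddPart k n)
  oddPart-unique zero = []
  oddPart-unique (suc m) = Unique.map⁺ (∷ʳ-injectiveˡ _ _) (qPerms-unique (suc m) 0 k m)

headOr-↭interval : ∀ {ρ a b w} → ρ ↭ interval a b → w ≤ a → ∃[ w′ ] (headOr ρ (just w) ≡ just w′ × w′ ≤ a + b)
headOr-↭interval {[]} {a} {b} {w} _ w≤a = w , refl , ≤-trans w≤a (m≤m+n a b)
headOr-↭interval {x ∷ ρ} ρ↭ _ = x , refl , proj₂ (↭interval⇒bounds ρ↭ (here refl))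

closing-Dumont : ∀ {a i γ} → IsEven (a + i) → γ ↭ interval a i → DumontFollowedBy γ nothing →
                 DumontFollowedBy (suc (suc (a + i)) ∷ (γ ∷ʳ suc (a + i))) nothing
closing-Dumont {a} {i} {[]} e _ _ = DumontStep-even (even-2+ e) ≤-refl , even-suc⇒Odd (even-2+ e) , tt
closing-Dumont {a} {i} {x ∷ γ} e γ↭ γd =
  DumontStep-even (even-2+ e) (m<n⇒m<1+n (γ<L (here refl))) ,
  DumontFollowedBy-++⁺ (x ∷ γ) [ L ] nothing (DumontFollowedBy-larger⁺ (x ∷ γ) L γd γ<L) (even-suc⇒Odd (even-2+ e) , tt)
  where
  L : ℕ
  L = suc (a + i)
  γ<L : AllBelow L (x ∷ γ)
  γ<L y∈ = s≤s (proj₂ (↭interval⇒bounds γ↭ y∈))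

Unique-split : ∀ u (x : ℕ) v → Unique (u ++ x ∷ v) → x ∉ u × x ∉ v × (∀ {y z} → y ∈ u → z ∈ v → y ≢ z)
Unique-split u x v unique with AllPairs-++⁻ u unique
... | _ , x∉v ∷ _ , cross = (λ x∈u → cross x∈u (here refl) refl) , (λ x∈v → All.lookup x∉v x∈v refl) , (λ y∈ z∈ → cross y∈ (there z∈))

headOr-++-∷ : ∀ v (z : ℕ) rest next → ∃[ h ] (headOr (v ++ z ∷ rest) next ≡ just h × (h ∈ v ⊎ h ≡ z))
headOr-++-∷ [] z rest next = z , refl , inj₂ refl
headOr-++-∷ (h ∷ v) z rest next = h , refl , inj₁ (here refl)

nonempty⇒0<length : ∀ {xs : List ℕ} → xs ≢ [] → 0 < length xs
nonempty⇒0<length {[]} xs≢[] = ⊥-elim (xs≢[] refl)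
nonempty⇒0<length {_ ∷ _} _ = s≤s z≤n

record TopSplit (a t : ℕ) (α β : List ℕ) : Set where
  field
    α₁ : List ℕ
    α≡ : α ≡ α₁ ∷ʳ (a + t)
    β-even : IsEven (length β)
    α₁↭ : α₁ ↭ interval (a + length β) (length α₁)
    β↭ : β ↭ interval a (length β)
    size : length α₁ + suc (length β) ≡ t

-- 132-avoidance puts α above β, so α is an interval. Its largest entry a + t is odd and no larger
-- entry of α can follow it, so it comes last; the least entry of α is followed by a larger one,
-- so it is odd, which makes the length of β even.
top-split : ∀ {a t α β next} → IsEven a → IsEven (suc t) →
            α ++ suc (a + t) ∷ β ↭ interval a (suc t) → ¬ Sublist132 (α ++ suc (a + t) ∷ β) →
            DumontFollowedBy (α ++ suc (a + t) ∷ β) next → α ≢ [] → TopSplit a t α β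
top-split {a} {t} {α} {β} {next} ea et π↭ avoids dumont α≢[] =
  record { α₁ = u ; α≡ = α≡ ; β-even = β-even ; α₁↭ = u↭ ; β↭ = β↭ ; size = size }
  where
  N : ℕ
  N = suc (a + t)
  c : ℕ
  c = a + t
  π-split : N ∉ α × N ∉ β × (∀ {y z} → y ∈ α → z ∈ β → y ≢ z)
  π-split = Unique-split α N β (↭interval⇒Unique π↭)
  x≤N : ∀ {x} → x ∈ α ++ N ∷ β → x ≤ N
  x≤N {x} x∈ = subst (x ≤_) (+-suc a t) (proj₂ (↭interval⇒bounds π↭ x∈))
  αβ<N : AllBelow N (α ++ β)
  αβ<N {x} x∈ with ∈-++⁻ α x∈
  ... | inj₁ x∈α = ≤∧≢⇒< (x≤N (∈-++⁺ˡ x∈α)) (λ { refl → proj₁ π-split x∈α })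
  ... | inj₂ x∈β = ≤∧≢⇒< (x≤N (∈-++⁺ʳ α (there x∈β))) (λ { refl → proj₁ (proj₂ π-split) x∈β })
  αβ↭ : α ++ β ↭ interval a t
  αβ↭ = drop-top α β π↭
  halves : β ↭ interval a (length β) × α ↭ interval (a + length β) (length α)
  halves = interval-split-above t a α β αβ↭ (avoids132⇒Above α N β avoids αβ<N (proj₂ (proj₂ π-split)))
  β↭ : β ↭ interval a (length β)
  β↭ = proj₁ halves
  α↭ : α ↭ interval (a + length β) (length α)
  α↭ = proj₂ halves
  c≡ : c ≡ a + length β + length α
  c≡ = trans (cong (_+_ a) (trans (sym (↭interval⇒length αβ↭)) (trans (length-++ α) (+-comm (length α) _))))
             (sym (+-assoc a _ _))
  c-odd : Odd c
  c-odd = even-suc⇒Odd (subst IsEven (+-suc a t) (even-+ ea et))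
  α≤c : ∀ {y} → y ∈ α → y ≤ c
  α≤c {y} y∈ = subst (y ≤_) (sym c≡) (proj₂ (↭interval⇒bounds α↭ y∈))
  c∈α : c ∈ α
  c∈α = ∈-resp-↭ (↭-sym α↭) (∈-interval⁺ (subst (a + length β <_) (sym c≡) (m<m+n (a + length β) (nonempty⇒0<length α≢[])))
                                        (≤-reflexive c≡))
  c-last : ∃[ u ] α ≡ u ∷ʳ c
  c-last with ∈-∃++ c∈α
  ... | u , [] , α≡ = u , α≡
  ... | u , h ∷ v , α≡ = ⊥-elim (<⇒≱ (proj₂ rise c-odd) (α≤c (subst (h ∈_) (sym α≡) (∈-++⁺ʳ u (there (here refl))))))
    where
    rise : DumontStep c (just h)
    rise = DumontStep-at u c (h ∷ v ++ N ∷ β) next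
             (subst (λ π → DumontFollowedBy π next) (trans (cong (_++ N ∷ β) α≡) (++-assoc u (c ∷ h ∷ v) (N ∷ β))) dumont)
  u : List ℕ
  u = proj₁ c-last
  α≡ : α ≡ u ∷ʳ c
  α≡ = proj₂ c-last
  |α|≡ : length α ≡ suc (length u)
  |α|≡ = trans (cong length α≡) (length-∷ʳ u c)
  size : length u + suc (length β) ≡ t
  size = trans (+-suc (length u) _) (trans (cong (_+ length β) (sym |α|≡))
               (trans (sym (length-++ α)) (↭interval⇒length αβ↭)))
  u↭ : u ↭ interval (a + length β) (length u)
  u↭ = subst (_↭ interval (a + length β) (length u)) (++-identityʳ u)
             (drop-top u [] (subst₂ (λ π x → π ↭ x ∷ interval (a + length β) (length u)) α≡ (sym c≡′)
                                    (subst (λ l → α ↭ interval (a + length β) l) |α|≡ α↭)))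
    where
    c≡′ : c ≡ suc (a + length β + length u)
    c≡′ = trans c≡ (trans (cong (_+_ (a + length β)) |α|≡) (+-suc _ _))
  μ : ℕ
  μ = suc (a + length β)
  μ∈α : μ ∈ α
  μ∈α = ∈-resp-↭ (↭-sym α↭) (∈-interval⁺ ≤-refl (m<m+n (a + length β) (nonempty⇒0<length α≢[])))
  β-even : IsEven (length β)
  β-even with ∈-∃++ μ∈α
  ... | u₂ , v₂ , α≡₂ with headOr-++-∷ v₂ N β next
  ... | h , head≡ , h∈ = even-+⁻ʳ ea (even-2+⁻ (Odd⇒even-suc (DumontStep-rise⇒Odd step μ<h)))
    where
    step : DumontStep μ (just h)
    step = subst (DumontStep μ) head≡
             (DumontStep-at u₂ μ (v₂ ++ N ∷ β) next
               (subst (λ π → DumontFollowedBy π next) (trans (cong (_++ N ∷ β) α≡₂) (++-assoc u₂ (μ ∷ v₂) (N ∷ β))) dumont))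
    μ∉v₂ : μ ∉ v₂
    μ∉v₂ = proj₁ (proj₂ (Unique-split u₂ μ v₂ (subst Unique α≡₂ (↭interval⇒Unique α↭))))
    μ<h : μ < h
    μ<h = μ<h′ h∈
      where
      μ<h′ : h ∈ v₂ ⊎ h ≡ N → μ < h
      μ<h′ (inj₂ refl) = αβ<N (∈-++⁺ˡ μ∈α)
      μ<h′ (inj₁ h∈v₂) = ≤∧≢⇒< (proj₁ (↭interval⇒bounds α↭ (subst (h ∈_) (sym α≡₂) (∈-++⁺ʳ u₂ (there h∈v₂)))))
                              (λ μ≡h → μ∉v₂ (subst (_∈ v₂) (sym μ≡h) h∈v₂))

even-suc⇒0< : ∀ {t} → IsEven (suc t) → 0 < t
even-suc⇒0< (even-2+ _) = s≤s z≤n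

top-first : ∀ {a t β next} → IsEven a → IsEven (suc t) → suc (a + t) ∷ β ↭ interval a (suc t) →
            DumontFollowedBy (suc (a + t) ∷ β) next → Maybe.All (_≤ a) next →
            ∃[ u ] (β ≡ u ∷ʳ (a + t) × next ≡ nothing)
top-first {a} {t} {β} {next} ea et π↭ dumont next≤a with ∈-resp-↭ (↭-sym π↭) c∈interval
  where
  c∈interval : a + t ∈ interval a (suc t)
  c∈interval = ∈-interval⁺ (m<m+n a (even-suc⇒0< et)) (+-monoʳ-≤ a (n≤1+n t))
... | here c≡N = ⊥-elim (<-irrefl c≡N (n<1+n (a + t)))
... | there c∈β with ∈-∃++ c∈β
... | u , v , β≡ = u , trans β≡ (cong (λ v → u ++ c ∷ v) v≡[]) , last (subst (DumontStep c ∘ (λ v → headOr v next)) v≡[] step) next≤a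
  where
  N : ℕ
  N = suc (a + t)
  c : ℕ
  c = a + t
  c-odd : Odd c
  c-odd = even-suc⇒Odd (subst IsEven (+-suc a t) (even-+ ea et))
  step : DumontStep c (headOr v next)
  step = DumontStep-at (N ∷ u) c v next (subst (λ π → DumontFollowedBy (N ∷ π) next) β≡ dumont)
  v≡[] : v ≡ []
  v≡[] = tail-empty v β≡ step
    where
    tail-empty : ∀ v → β ≡ u ++ c ∷ v → DumontStep c (headOr v next) → v ≡ []
    tail-empty [] _ _ = refl
    tail-empty (h ∷ _) β≡ (_ , rise) = ⊥-elim (<⇒≱ (rise c-odd) (s≤s⁻¹ (≤∧≢⇒< h≤N (λ h≡N → N∉β (subst (_∈ β) h≡N h∈β)))))
      where
      h∈β : h ∈ β
      h∈β = subst (h ∈_) (sym β≡) (∈-++⁺ʳ u (there (here refl)))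
      h≤N : h ≤ N
      h≤N = subst (h ≤_) (+-suc a t) (proj₂ (↭interval⇒bounds π↭ (there h∈β)))
      N∉β : N ∉ β
      N∉β = proj₁ (proj₂ (Unique-split [] N β (↭interval⇒Unique π↭)))
  last : ∀ {next} → DumontStep c next → Maybe.All (_≤ a) next → next ≡ nothing
  last {nothing} _ _ = refl
  last {just w} (_ , rise) (Maybe.just w≤a) = ⊥-elim (<⇒≱ (rise c-odd) (≤-trans w≤a (m≤m+n a t)))

module Enumeration {P : ℕ → List ℕ → Set} (patternP : IncreasingPattern P) where

  open IncreasingPattern patternP

  -- QPerm a n k and IPerm a n k are the permutations of (a, a + n] counted by Q k and I k.
  -- An IPerm stands in front of smaller entries, so its last entry may be even.
  record QPerm (a n k : ℕ) (π : List ℕ) : Set where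
    constructor qPerm
    field
      ↭interval : π ↭ interval a n
      dumont : DumontFollowedBy π nothing
      avoids132 : ¬ Sublist132 π
      avoidsP : ¬ P k π

  record IPerm (a n k : ℕ) (π : List ℕ) : Set where
    constructor iPerm
    field
      ↭interval : π ↭ interval a n
      dumont : ∀ w → w ≤ a → DumontFollowedBy π (just w)
      avoids132 : ¬ Sublist132 π
      avoidsP : ¬ P (suc (suc k)) π

  avoids-∷ʳ-max : ∀ {k xs M} → AllBelow M xs → ¬ P k xs → ¬ P (suc k) (xs ∷ʳ M)
  avoids-∷ʳ-max {k} {xs} {M} below avoids = avoids ∘ ∷ʳ-max⁻ k xs M below

  avoids-++ : ∀ {k xs ys} → Above xs ys → ¬ P k xs → ¬ P k ys → ¬ P k (xs ++ ys)
  avoids-++ {k} {xs} {ys} above avoidsˡ avoidsʳ h with split-above k xs ys above h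
  ... | inj₁ hˡ = avoidsˡ hˡ
  ... | inj₂ hʳ = avoidsʳ hʳ

  avoids132-++ : ∀ {xs ys} → Above xs ys → ¬ Sublist132 xs → ¬ Sublist132 ys → ¬ Sublist132 (xs ++ ys)
  avoids132-++ {xs} {ys} above avoidsˡ avoidsʳ h with Sublist132-split xs ys above h
  ... | inj₁ hˡ = avoidsˡ hˡ
  ... | inj₂ hʳ = avoidsʳ hʳ

  closeWith-QPerm : ∀ {a i r γ σ k} → IsEven (a + i) →
                    QPerm a i (suc k) γ → IPerm (suc (suc (a + i))) r k σ →
                    QPerm a (suc (suc (i + r))) (suc (suc k)) (closeWith (a + i) γ σ)
  closeWith-QPerm {a} {i} {r} {γ} {σ} {k} e (qPerm γ↭ γd γ132 γP) (iPerm σ↭ σd σ132 σP) =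
    qPerm (closeWith-↭ γ↭ σ↭)
          (DumontFollowedBy-++⁺ σ B nothing (σd M ≤-refl) (closing-Dumont e γ↭ γd))
          (avoids132-++ σ-above-B σ132 (γ132 ∘ Sublist132-∷ʳ-max⁻ γ L γ<L ∘ Sublist132-max∷⁻ M (γ ∷ʳ L) M-above))
          (avoids-++ σ-above-B σP (avoids-++ M-above (avoids-singleton k M) (avoids-∷ʳ-max γ<L γP)))
    where
    M : ℕ
    M = suc (suc (a + i))
    L : ℕ
    L = suc (a + i)
    B : List ℕ
    B = M ∷ (γ ∷ʳ L)
    γ<L : AllBelow L γ
    γ<L x∈ = s≤s (proj₂ (↭interval⇒bounds γ↭ x∈))
    B≤M : ∀ {y} → y ∈ B → y ≤ M
    B≤M {y} y∈ = subst (y ≤_) (trans (+-suc a (suc i)) (cong suc (+-suc a i))) (proj₂ (↭interval⇒bounds (closing-↭ γ↭) y∈))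
    σ-above-B : Above σ B
    σ-above-B x∈ y∈ = ≤-<-trans (B≤M y∈) (proj₁ (↭interval⇒bounds σ↭ x∈))
    M-above : Above [ M ] (γ ∷ʳ L)
    M-above (here refl) y∈ with ∈-++⁻ γ y∈
    ... | inj₁ y∈γ = m<n⇒m<1+n (γ<L y∈γ)
    ... | inj₂ (here refl) = ≤-refl

  block++-IPerm : ∀ {a b j α ρ k} → IsEven a → IsEven (suc (suc (j + b))) →
                  QPerm (a + b) j k α → IPerm a b k ρ → IPerm a (suc (suc (j + b))) k (block (suc (a + b + j)) α ++ ρ)
  block++-IPerm {a} {b} {j} {α} {ρ} {k} ea en (qPerm α↭ αd α132 αP) (iPerm ρ↭ ρd ρ132 ρP) =
    iPerm (block++-↭ α↭ ρ↭) dumont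
          (avoids132-++ B-above-ρ (α132 ∘ Sublist132-∷ʳ-max⁻ α c α<c ∘ Sublist132-∷ʳ-max⁻ (α ∷ʳ c) d αc<d ∘ subst Sublist132 (block-∷ʳ c α)) ρ132)
          (avoids-++ B-above-ρ (avoids-∷ʳ-max αc<d (avoids-∷ʳ-max α<c αP) ∘ subst (P (suc (suc k))) (block-∷ʳ c α)) ρP)
    where
    c : ℕ
    c = suc (a + b + j)
    d : ℕ
    d = suc c
    B : List ℕ
    B = block c α
    α<c : AllBelow c α
    α<c x∈ = s≤s (proj₂ (↭interval⇒bounds α↭ x∈))
    αc<d : AllBelow d (α ∷ʳ c)
    αc<d y∈ with ∈-++⁻ α y∈
    ... | inj₁ y∈α = m<n⇒m<1+n (α<c y∈α)
    ... | inj₂ (here refl) = ≤-refl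
    B-above-ρ : Above B ρ
    B-above-ρ x∈ y∈ = ≤-<-trans (proj₂ (↭interval⇒bounds ρ↭ y∈)) (proj₁ (↭interval⇒bounds (block-↭ α↭) x∈))
    ed : IsEven d
    ed = subst IsEven (trans (+-suc a _) (cong suc (block-top a j b))) (even-+ ea en)
    dumont : ∀ w → w ≤ a → DumontFollowedBy (B ++ ρ) (just w)
    dumont w w≤a with headOr-↭interval ρ↭ w≤a
    ... | w′ , head≡ , w′≤ =
      DumontFollowedBy-++⁺ B ρ (just w)
        (subst (DumontFollowedBy B) (sym head≡)
          (DumontFollowedBy-++⁺ α (c ∷ d ∷ []) (just w′) (DumontFollowedBy-larger⁺ α c αd α<c)
            (DumontStep-odd ed ≤-refl , DumontStep-even ed (s≤s (≤-trans w′≤ (≤-trans (m≤m+n (a + b) j) (n≤1+n _)))) , tt)))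
        (ρd w w≤a)

  mutual
    qPerms-sound : ∀ f a k n {π} → IsEven a → π ∈ qPerms f a k n → QPerm a n k π
    qPerms-sound (suc f) a (suc k) zero ea (here refl) = qPerm ↭-refl tt ¬Sublist132-[] (empty-avoids k)
    qPerms-sound (suc f) a (suc (suc k)) (suc (suc m)) ea π∈ with ∈-qPerms⁻ f a k m π∈
    ... | i , r , γ , σ , refl , γ∈ , σ∈ , refl =
      closeWith-QPerm ea+i (qPerms-sound f a (suc k) i ea γ∈) (iPerms-sound f _ k r (even-2+ ea+i) σ∈)
      where
      ea+i : IsEven (a + i)
      ea+i = even-+ ea (qPerms-even f a (suc k) i γ∈)

    iPerms-sound : ∀ f a k n {π} → IsEven a → π ∈ iPerms f a k n → IPerm a n k π
    iPerms-sound (suc f) a k zero ea (here refl) = iPerm ↭-refl (λ _ _ → tt) ¬Sublist132-[] (empty-avoids (suc k))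
    iPerms-sound (suc f) a k (suc n) ea π∈ with ∈-iPerms⁻ f a k n π∈
    ... | j , b , α , ρ , refl , α∈ , ρ∈ , refl =
      block++-IPerm ea (iPerms-even (suc f) a k (suc n) π∈)
                    (qPerms-sound f (a + b) k j (even-+ ea (iPerms-even f a k b ρ∈)) α∈) (iPerms-sound f a k b ea ρ∈)


  record FirstBlock (a t k : ℕ) (α β : List ℕ) : Set where
    constructor firstBlock
    field
      α₁ : List ℕ
      t≡ : t ≡ suc (length α₁ + length β)
      π≡ : α ++ suc (a + t) ∷ β ≡ block (suc (a + length β + length α₁)) α₁ ++ β
      α₁-even : IsEven (length α₁)
      β-even : IsEven (length β)
      α₁-QPerm : QPerm (a + length β) (length α₁) k α₁
      β↭ : β ↭ interval a (length β)

  first-block : ∀ {a t k α β next} → IsEven a → IsEven (suc t) → α ≢ [] →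
                α ++ suc (a + t) ∷ β ↭ interval a (suc t) → DumontFollowedBy (α ++ suc (a + t) ∷ β) next →
                ¬ Sublist132 (α ++ suc (a + t) ∷ β) → ¬ P (suc (suc k)) (α ++ suc (a + t) ∷ β) → FirstBlock a t k α β
  first-block {a} {t} {k} {α} {β} {next} ea et α≢[] π↭ πd π132 πP =
    firstBlock α₁ t≡ (trans π≡₀ (cong (λ c → block c α₁ ++ β) c≡)) α₁-even β-even
      (qPerm α₁↭ α₁d (π132 ∘ subst Sublist132 (sym π≡₁) ∘ Sublist132-weakenʳ (c ∷ N ∷ β))
             (πP ∘ subst (P (suc (suc k))) (sym π≡₀) ∘ weakenʳ _ (block c α₁) β ∘ subst (P (suc (suc k))) (sym (block-∷ʳ c α₁))
                 ∘ ∷ʳ-max⁺ (suc k) (α₁ ∷ʳ c) N α₁c<N ∘ ∷ʳ-max⁺ k α₁ c α₁<c))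
      β↭
    where
    open TopSplit (top-split ea et π↭ π132 πd α≢[])
    N : ℕ
    N = suc (a + t)
    c : ℕ
    c = a + t
    j : ℕ
    j = length α₁
    b : ℕ
    b = length β
    t≡ : t ≡ suc (j + b)
    t≡ = trans (sym size) (+-suc j b)
    c≡ : c ≡ suc (a + b + j)
    c≡ = trans (cong (_+_ a) t≡) (block-top a j b)
    π≡₁ : α ++ N ∷ β ≡ α₁ ++ c ∷ N ∷ β
    π≡₁ = trans (cong (_++ N ∷ β) α≡) (++-assoc α₁ [ c ] (N ∷ β))
    π≡₀ : α ++ N ∷ β ≡ block c α₁ ++ β
    π≡₀ = trans π≡₁ (sym (++-assoc α₁ (c ∷ N ∷ []) β))
    α₁<c : AllBelow c α₁
    α₁<c {x} x∈ = subst (x <_) (sym c≡) (s≤s (proj₂ (↭interval⇒bounds α₁↭ x∈)))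
    α₁c<N : AllBelow N (α₁ ∷ʳ c)
    α₁c<N y∈ with ∈-++⁻ α₁ y∈
    ... | inj₁ y∈α₁ = m<n⇒m<1+n (α₁<c y∈α₁)
    ... | inj₂ (here refl) = ≤-refl
    α₁d : DumontFollowedBy α₁ nothing
    α₁d = DumontFollowedBy-larger⁻ α₁ c (proj₁ (DumontFollowedBy-++⁻ α₁ (c ∷ N ∷ β) next (subst (λ π → DumontFollowedBy π next) π≡₁ πd))) α₁<c
    α₁-even : IsEven j
    α₁-even = even-+⁻ʳ β-even (even-2+⁻ (subst IsEven (cong suc (trans t≡ (cong suc (+-comm j b)))) et))

  DumontFollowedBy-suffix : ∀ xs {y ys next} → DumontFollowedBy (xs ++ y ∷ ys) next → DumontFollowedBy ys next
  DumontFollowedBy-suffix xs {y} {ys} {next} d = proj₂ (proj₂ (DumontFollowedBy-++⁻ xs (y ∷ ys) next d))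

  IPermSplit : ℕ → ℕ → ℕ → List ℕ → Set
  IPermSplit a n k π = ∃[ j ] ∃[ b ] ∃[ α ] ∃[ ρ ] (n ≡ suc (j + b) × π ≡ block (suc (a + b + j)) α ++ ρ ×
                                                     IsEven j × QPerm (a + b) j k α × IsEven b × IPerm a b k ρ)

  QPermSplit : ℕ → ℕ → ℕ → List ℕ → Set
  QPermSplit a m k π = ∃[ i ] ∃[ r ] ∃[ γ ] ∃[ σ ] (m ≡ i + r × π ≡ closeWith (a + i) γ σ ×
                                                     IsEven i × QPerm a i (suc k) γ × IsEven r × IPerm (suc (suc (a + i))) r k σ)

  IPerm-decompose : ∀ {a n k π} → IsEven a → IsEven (suc n) → IPerm a (suc n) k π → IPermSplit a n k π
  IPerm-decompose {a} {n} {k} ea en (iPerm π↭ πd π132 πP) with ∈-∃++ (∈-resp-↭ (↭-sym π↭) (here refl))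
  ... | [] , β , refl with top-first ea en π↭ (πd a ≤-refl) (Maybe.just ≤-refl)
  ...   | _ , _ , ()
  IPerm-decompose {a} {n} {k} ea en (iPerm π↭ πd π132 πP) | x ∷ α , β , refl =
    length α₁ , length β , α₁ , β , t≡ , π≡ , α₁-even , α₁-QPerm , β-even ,
    iPerm β↭ (λ w w≤a → DumontFollowedBy-suffix (x ∷ α) (πd w w≤a))
          (π132 ∘ Sublist132-weakenˡ (x ∷ α) ∘ Sublist132-weakenˡ [ suc (a + n) ])
          (πP ∘ weakenˡ _ (x ∷ α) _ ∘ weakenˡ _ [ suc (a + n) ] β)
    where open FirstBlock (first-block {a} {n} {k} {x ∷ α} {β} ea en (λ ()) π↭ (πd a ≤-refl) π132 πP)

  QPerm-top-first : ∀ {a m k β} → IsEven a → IsEven m → QPerm a (suc (suc m)) (suc (suc k)) (suc (a + suc m) ∷ β) →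
                    ∃[ γ ] (suc (a + suc m) ∷ β ≡ closeWith (a + m) γ [] × QPerm a m (suc k) γ)
  QPerm-top-first {a} {m} {k} {β} ea em (qPerm π↭ πd π132 πP) with top-first ea (even-2+ em) π↭ πd Maybe.nothing
  ... | γ , β≡ , _ =
    γ , cong₂ _∷_ (cong suc c≡) (trans β≡ (cong (γ ∷ʳ_) c≡)) ,
    qPerm γ↭ (DumontFollowedBy-larger⁻ γ c γd γ<c)
          (π132 ∘ Sublist132-weakenˡ [ N ] ∘ subst Sublist132 (sym β≡) ∘ Sublist132-weakenʳ [ c ])
          (πP ∘ weakenˡ _ [ N ] β ∘ subst (P (suc (suc k))) (sym β≡) ∘ ∷ʳ-max⁺ (suc k) γ c γ<c)
    where
    N : ℕ
    N = suc (a + suc m)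
    c : ℕ
    c = a + suc m
    c≡ : c ≡ suc (a + m)
    c≡ = +-suc a m
    γ↭ : γ ↭ interval a m
    γ↭ = subst (_↭ interval a m) (++-identityʳ γ)
               (drop-top γ [] (subst₂ (λ π x → π ↭ x ∷ interval a m) β≡ (sym c≡) (drop-∷ π↭)))
    γ<c : AllBelow c γ
    γ<c {x} x∈ = subst (x <_) (sym c≡) (s≤s (proj₂ (↭interval⇒bounds γ↭ x∈)))
    γd : DumontFollowedBy γ (just c)
    γd = proj₁ (DumontFollowedBy-++⁻ γ [ c ] nothing (subst (λ π → DumontFollowedBy π nothing) β≡ (proj₂ πd)))

  -- The maximum N either comes first, and then π = N γ (N - 1), or it closes a first block α₁ (N - 1) N
  -- followed by a smaller QPerm, which is decomposed recursively.
  QPerm-decompose : ∀ F {a m k π} → m < F → IsEven a → IsEven m → QPerm a (suc (suc m)) (suc (suc k)) π → QPermSplit a m k π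
  QPerm-decompose (suc F) {a} {m} {k} m<F ea em πQ@(qPerm π↭ πd π132 πP) with ∈-∃++ (∈-resp-↭ (↭-sym π↭) (here refl))
  ... | [] , β , refl with QPerm-top-first ea em πQ
  ...   | γ , π≡ , γQ = m , 0 , γ , [] , sym (+-identityʳ m) , π≡ , em , γQ , even-0 ,
                        iPerm ↭-refl (λ _ _ → tt) ¬Sublist132-[] (empty-avoids (suc k))
  QPerm-decompose (suc F) {a} {m} {k} m<F ea em (qPerm π↭ πd π132 πP) | x ∷ α , [] , refl =
    ⊥-elim (DumontStep-at (x ∷ α) N [] nothing πd (IsEven⇒Even (subst IsEven (+-suc a (suc m)) (even-+ ea (even-2+ em)))))
    where
    N : ℕ
    N = suc (a + suc m)
  QPerm-decompose (suc F) {a} {m} {k} m<F ea em (qPerm π↭ πd π132 πP) | x ∷ α , y ∷ [] , refl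
    with FirstBlock.β-even (first-block {a} {suc m} {k} {x ∷ α} {[ y ]} ea (even-2+ em) (λ ()) π↭ πd π132 πP)
  ... | ()
  QPerm-decompose (suc F) {a} {m} {k} m<F ea em (qPerm π↭ πd π132 πP) | x ∷ α , y ∷ y′ ∷ β , refl =
    extend (QPerm-decompose F |β|<F ea (even-2+⁻ β-even)
             (qPerm β↭ (DumontFollowedBy-suffix (x ∷ α) πd)
                    (π132 ∘ Sublist132-weakenˡ (x ∷ α) ∘ Sublist132-weakenˡ [ N ])
                    (πP ∘ weakenˡ _ (x ∷ α) _ ∘ weakenˡ _ [ N ] (y ∷ y′ ∷ β))))
    where
    open FirstBlock (first-block {a} {suc m} {k} {x ∷ α} {y ∷ y′ ∷ β} ea (even-2+ em) (λ ()) π↭ πd π132 πP)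
    N : ℕ
    N = suc (a + suc m)
    j : ℕ
    j = length α₁
    m≡ : m ≡ j + suc (suc (length β))
    m≡ = suc-injective t≡
    |β|<F : length β < F
    |β|<F = ≤-trans (≤-trans (n≤1+n _) (subst (_ ≤_) (sym m≡) (m≤n+m _ j))) (s≤s⁻¹ m<F)
    extend : QPermSplit a (length β) k (y ∷ y′ ∷ β) → QPermSplit a m k ((x ∷ α) ++ N ∷ y ∷ y′ ∷ β)
    extend (i , r , γ , σ , |β|≡ , β≡ , ei , γQ , er , σI) =
      i , suc (suc (j + r)) , γ , block c′ α₁ ++ σ , trans m≡ (m≡′) , π≡′ , ei , γQ , even-2+ (even-+ α₁-even er) ,
      block++-IPerm (even-2+ (even-+ ea ei)) (even-2+ (even-+ α₁-even er)) (subst (λ o → QPerm o j k α₁) offset≡ α₁-QPerm) σI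
      where
      c′ : ℕ
      c′ = suc (suc (suc (a + i)) + r + j)
      offset≡ : a + suc (suc (length β)) ≡ suc (suc (a + i)) + r
      offset≡ = trans (cong (λ l → a + suc (suc l)) |β|≡) (shift-offset a i r)
        where
        shift-offset : ∀ a i r → a + suc (suc (i + r)) ≡ suc (suc (a + i)) + r
        shift-offset = solve-∀
      m≡′ : j + suc (suc (length β)) ≡ i + suc (suc (j + r))
      m≡′ = trans (cong (λ l → j + suc (suc l)) |β|≡) (regroup j i r)
        where
        regroup : ∀ j i r → j + suc (suc (i + r)) ≡ i + suc (suc (j + r))
        regroup = solve-∀
      π≡′ : (x ∷ α) ++ N ∷ y ∷ y′ ∷ β ≡ closeWith (a + i) γ (block c′ α₁ ++ σ)
      π≡′ = trans π≡ (trans (cong₂ (λ c ρ → block c α₁ ++ ρ) (cong (λ o → suc (o + j)) offset≡) β≡)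
                            (sym (++-assoc (block c′ α₁) σ _)))

  mutual
    qPerms-complete : ∀ f {a k n π} → n < f → IsEven a → IsEven n → QPerm a n k π → π ∈ qPerms f a k n
    qPerms-complete (suc f) {k = zero} {π = π} _ _ _ (qPerm _ _ _ πP) = ⊥-elim (πP (contains-0 π))
    qPerms-complete (suc f) {k = suc k} {zero} _ _ _ (qPerm π↭ _ _ _) rewrite ↭-empty-inv π↭ = here refl
    qPerms-complete (suc f) {k = suc k} {suc zero} _ _ () _
    qPerms-complete (suc f) {k = suc zero} {suc (suc m)} {[]} _ _ _ (qPerm π↭ _ _ _) with ↭-length π↭
    ... | ()
    qPerms-complete (suc f) {k = suc zero} {suc (suc m)} {x ∷ xs} _ _ _ (qPerm _ _ _ πP) = ⊥-elim (πP (contains-1 x xs))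
    qPerms-complete (suc f) {a} {suc (suc k)} {suc (suc m)} n<f ea (even-2+ em) πQ
      with QPerm-decompose (suc m) ≤-refl ea em πQ
    ... | i , r , γ , σ , refl , refl , ei , γQ , er , σI =
      ∈-qPerms⁺ f a k (qPerms-complete f (≤-<-trans (m≤m+n i r) i+r<f) ea ei γQ)
                      (iPerms-complete f (≤-<-trans (m≤n+m r i) i+r<f) (even-2+ (even-+ ea ei)) er σI)
      where
      i+r<f : i + r < f
      i+r<f = <-trans (n<1+n _) (s≤s⁻¹ n<f)

    iPerms-complete : ∀ f {a k n π} → n < f → IsEven a → IsEven n → IPerm a n k π → π ∈ iPerms f a k n
    iPerms-complete (suc f) {n = zero} _ _ _ (iPerm π↭ _ _ _) rewrite ↭-empty-inv π↭ = here refl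
    iPerms-complete (suc f) {a} {k} {suc n} n<f ea en πI with IPerm-decompose ea en πI
    ... | j , b , α , ρ , refl , refl , ej , αQ , eb , ρI =
      ∈-iPerms⁺ f a k (qPerms-complete f (≤-<-trans (m≤m+n j b) j+b<f) (even-+ ea eb) ej αQ)
                      (iPerms-complete f (≤-<-trans (m≤n+m b j) j+b<f) ea eb ρI)
      where
      j+b<f : j + b < f
      j+b<f = <-trans (n<1+n _) (s≤s⁻¹ n<f)

  QPerm-∷ʳ-max⁺ : ∀ {a m k α} → IsEven (a + m) → QPerm a m k α → QPerm a (suc m) (suc k) (α ∷ʳ suc (a + m))
  QPerm-∷ʳ-max⁺ {a} {m} {k} {α} e (qPerm α↭ αd α132 αP) =
    qPerm (↭-trans (↭-sym (∷↭∷ʳ T α)) (prep T α↭))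
          (DumontFollowedBy-++⁺ α [ T ] nothing (DumontFollowedBy-larger⁺ α T αd α<T) (even-suc⇒Odd (even-2+ e) , tt))
          (α132 ∘ Sublist132-∷ʳ-max⁻ α T α<T) (αP ∘ ∷ʳ-max⁻ k α T α<T)
    where
    T : ℕ
    T = suc (a + m)
    α<T : AllBelow T α
    α<T x∈ = s≤s (proj₂ (↭interval⇒bounds α↭ x∈))

  QPerm-∷ʳ-max⁻ : ∀ {a m k π} → IsEven (a + m) → QPerm a (suc m) (suc k) π →
                  ∃[ α ] (π ≡ α ∷ʳ suc (a + m) × QPerm a m k α)
  QPerm-∷ʳ-max⁻ {a} {m} {k} e (qPerm π↭ πd π132 πP) with ∈-∃++ (∈-resp-↭ (↭-sym π↭) (here refl))
  ... | α , h ∷ β , refl = ⊥-elim (<⇒≱ (proj₂ (DumontStep-at α T (h ∷ β) nothing πd) (even-suc⇒Odd (even-2+ e)))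
                                       (≤-trans (proj₂ (↭interval⇒bounds π↭ (∈-++⁺ʳ α (there (here refl))))) (≤-reflexive (+-suc a m))))
    where
    T : ℕ
    T = suc (a + m)
  ... | α , [] , refl =
    α , refl , qPerm α↭ (DumontFollowedBy-larger⁻ α T (proj₁ (DumontFollowedBy-++⁻ α [ T ] nothing πd)) α<T)
                     (π132 ∘ Sublist132-weakenʳ [ T ]) (πP ∘ ∷ʳ-max⁺ k α T α<T)
    where
    T : ℕ
    T = suc (a + m)
    α↭ : α ↭ interval a m
    α↭ = subst (_↭ interval a m) (++-identityʳ α) (drop-top α [] π↭)
    α<T : AllBelow T α
    α<T x∈ = s≤s (proj₂ (↭interval⇒bounds α↭ x∈))

  avoiders-sound : ∀ k n {π} → π ∈ avoiders k n → QPerm 0 n (suc k) π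
  avoiders-sound k n π∈ with ∈-++⁻ (qPerms (suc n) 0 (suc k) n) π∈
  ... | inj₁ π∈q = qPerms-sound (suc n) 0 (suc k) n even-0 π∈q
  avoiders-sound k (suc m) π∈ | inj₂ π∈o with ∈-map⁻ (_∷ʳ suc m) π∈o
  ... | α , α∈ , refl =
    QPerm-∷ʳ-max⁺ (qPerms-even (suc m) 0 k m α∈) (qPerms-sound (suc m) 0 k m even-0 α∈)

  avoiders-complete : ∀ k n {π} → QPerm 0 n (suc k) π → π ∈ avoiders k n
  avoiders-complete k n πQ with even-or-odd n
  ... | inj₁ en = ∈-++⁺ˡ (qPerms-complete (suc n) ≤-refl even-0 en πQ)
  avoiders-complete k (suc m) πQ | inj₂ (even-2+ em) with QPerm-∷ʳ-max⁻ em πQ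
  ... | α , refl , αQ = ∈-++⁺ʳ (qPerms (suc (suc m)) 0 (suc k) (suc m)) (∈-map⁺ (_∷ʳ suc m) (qPerms-complete (suc m) ≤-refl even-0 em αQ))

module Characterisation {P : ℕ → List ℕ → Set} (patternP : IncreasingPattern P) (Cont : ℕ → List ℕ → Set)
  (Cont⇒P : ∀ k π → Cont k π → P k π) (P⇒Cont : ∀ k π → P k π → Cont k π) where

  open Enumeration patternP

  DumontAvoiding : ℕ → ℕ → List ℕ → Set
  DumontAvoiding k n π = IsDumont n π × ¬ Contains132 π × ¬ Cont k π

  DumontAvoiding⇒QPerm : ∀ {k n π} → DumontAvoiding k n π → QPerm 0 n k π
  DumontAvoiding⇒QPerm {k} {n} {π} ((π↭ , dumont) , avoids132 , avoids) =
    qPerm (↭-trans π↭ (upTo↭interval n)) (IsDumontList⇒DumontFollowedBy π dumont)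
          (avoids132 ∘ Sublist132⇒Contains132 π) (avoids ∘ P⇒Cont k π)

  QPerm⇒DumontAvoiding : ∀ {k n π} → QPerm 0 n k π → DumontAvoiding k n π
  QPerm⇒DumontAvoiding {k} {n} {π} (qPerm π↭ dumont avoids132 avoids) =
    (↭-trans π↭ (↭-sym (upTo↭interval n)) , DumontFollowedBy⇒IsDumontList π dumont) ,
    avoids132 ∘ Contains132⇒Sublist132 π , avoids ∘ Cont⇒P k π

  avoiders-spec : ∀ k n π → π ∈ avoiders k n ⇔ DumontAvoiding (suc k) n π
  avoiders-spec k n π = mk⇔ (QPerm⇒DumontAvoiding ∘ avoiders-sound k n) (avoiders-complete k n ∘ DumontAvoiding⇒QPerm)

theorem2p10 :
  (Q I : ℕ → Series) →
  Q 0 ≈ˢ 0ˢ →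
  Q 1 ≈ˢ 1ˢ →
  ((r : ℕ) → ((1ˢ -ˢ x²ˢ (Q r)) *ˢ I r) ≈ˢ 1ˢ) →
  ((r : ℕ) → 2 ≤ r → Q r ≈ˢ (1ˢ +ˢ x²ˢ (Q (r ∸ 1) *ˢ I (r ∸ 2)))) →
  (k : ℕ) → 1 ≤ k → (n : ℕ) →
    (∃[ L ] (Unique L
      × ((π : List ℕ) → (π ∈ L) ⇔ (IsDumont n π × ¬ Contains132 π × ¬ ContainsAdjInc k π))
      × (+ length L) ≡ (Q k +ˢ xˢ (Q (k ∸ 1))) n))
    × (∃[ L ] (Unique L
      × ((π : List ℕ) → (π ∈ L) ⇔ (IsDumont n π × ¬ Contains132 π × ¬ ContainsInc k π))
      × (+ length L) ≡ (Q k +ˢ xˢ (Q (k ∸ 1))) n))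
theorem2p10 Q I Q0 Q1 I-inverse Q-rec (suc k) (s≤s z≤n) n =
  (avoiders k n , avoiders-unique k n , Adj.avoiders-spec k n , length-avoiders k n) ,
  (avoiders k n , avoiders-unique k n , Inc.avoiders-spec k n , length-avoiders k n)
  where
  open Counting Q I Q0 Q1 I-inverse Q-rec
  module Adj = Characterisation adjIncreasingSublist ContainsAdjInc
                 ContainsAdjInc⇒AdjIncreasingSublist AdjIncreasingSublist⇒ContainsAdjInc
  module Inc = Characterisation increasingSublist ContainsInc
                 ContainsInc⇒IncreasingSublist IncreasingSublist⇒ContainsInc
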